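{- Let $A\in SL(2,\mathbb Z)$ with $|\operatorname{tr}A|>2$ and let $\epsilon>0$. There is a constant $C=C(A,\epsilon)$ such that for every squarefree $N$ and every nonzero $n\in\mathbb Z^2$ (a row vector), the number of $(i,j,k,l)$ with $1\le i,j,k,l\le\operatorname{ord}(A,N)$ and $$n(A^i-A^j+A^k-A^l)\equiv0\pmod N$$ is at most $C\,|n|_2^{8+\epsilon}\,3^{\omega(N)}\operatorname{ord}(A,N)^2$.
   Context: $\operatorname{ord}(A,N)$ is the least integer $k\ge1$ with $A^k\equiv I\pmod N$; $\omega(N)$ is the number of distinct prime divisors of $N$; $|n|_2$ is the Euclidean norm of $n$.
   Formalization: The parameter ε ranges over the positive rationals. -}

module Defs where

open import Data.Nat as ℕ using (ℕ; zero; suc; _≤_; _<_)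
open import Data.Nat.Divisibility as ND using (_∣?_)
open import Data.Nat.Primality using (Prime; prime?)
open import Data.Integer as ℤ using (ℤ; +_; ∣_∣)
open import Data.Product using (_×_; _,_)
open import Data.List using (List; length; filter; upTo; map; concatMap)
open import Relation.Nullary using (Dec; yes; no; ¬_)
open import Relation.Nullary.Decidable using (_×-dec_)

record Mat2 : Set where
  constructor mat
  field
    a b c d : ℤ
open Mat2 public

det : Mat2 → ℤ
det M = a M ℤ.* d M ℤ.- b M ℤ.* c M

tr : Mat2 → ℤ
tr M = a M ℤ.+ d M

InSL2 : Mat2 → Set
InSL2 M = det M ≡ℤ + 1
  where open import Relation.Binary.PropositionalEquality renaming (_≡_ to _≡ℤ_)

_⊗_ : Mat2 → Mat2 → Mat2
M ⊗ P = mat (a M ℤ.* a P ℤ.+ b M ℤ.* c P) (a M ℤ.* b P ℤ.+ b M ℤ.* d P)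
            (c M ℤ.* a P ℤ.+ d M ℤ.* c P) (c M ℤ.* b P ℤ.+ d M ℤ.* d P)

I₂ : Mat2
I₂ = mat (+ 1) (+ 0) (+ 0) (+ 1)

_^ᴹ_ : Mat2 → ℕ → Mat2
M ^ᴹ zero = I₂
M ^ᴹ suc k = M ⊗ (M ^ᴹ k)

_⊕_ : Mat2 → Mat2 → Mat2
M ⊕ P = mat (a M ℤ.+ a P) (b M ℤ.+ b P) (c M ℤ.+ c P) (d M ℤ.+ d P)

_⊖_ : Mat2 → Mat2 → Mat2
M ⊖ P = mat (a M ℤ.- a P) (b M ℤ.- b P) (c M ℤ.- c P) (d M ℤ.- d P)

_≡0mod_ : ℤ → ℕ → Set
x ≡0mod N = N ND.∣ ∣ x ∣

_≡0mod?_ : (x : ℤ) (N : ℕ) → Dec (x ≡0mod N)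
x ≡0mod? N = N ∣? ∣ x ∣

_≡ᴹ_[mod_] : Mat2 → Mat2 → ℕ → Set
M ≡ᴹ P [mod N ] = ((M ⊖ P) .a ≡0mod N) × ((M ⊖ P) .b ≡0mod N)
                × ((M ⊖ P) .c ≡0mod N) × ((M ⊖ P) .d ≡0mod N)

IsOrd : Mat2 → ℕ → ℕ → Set
IsOrd A N k = (1 ≤ k) × ((A ^ᴹ k) ≡ᴹ I₂ [mod N ])
            × (∀ j → 1 ≤ j → j < k → ¬ ((A ^ᴹ j) ≡ᴹ I₂ [mod N ]))

Vec2 : Set
Vec2 = ℤ × ℤ

_·ᴹ_ : Vec2 → Mat2 → Vec2
(x , y) ·ᴹ M = (x ℤ.* a M ℤ.+ y ℤ.* c M , x ℤ.* b M ℤ.+ y ℤ.* d M)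

Vec≡0mod : Vec2 → ℕ → Set
Vec≡0mod (x , y) N = (x ≡0mod N) × (y ≡0mod N)

Vec≡0mod? : (v : Vec2) (N : ℕ) → Dec (Vec≡0mod v N)
Vec≡0mod? (x , y) N = (x ≡0mod? N) ×-dec (y ≡0mod? N)

NonZeroVec : Vec2 → Set
NonZeroVec (x , y) = ¬ (x ≡ℤ + 0 × y ≡ℤ + 0)
  where open import Relation.Binary.PropositionalEquality renaming (_≡_ to _≡ℤ_)

normSq : Vec2 → ℕ
normSq (x , y) = ∣ x ℤ.* x ℤ.+ y ℤ.* y ∣

range1 : ℕ → List ℕ
range1 m = map suc (upTo m)

quads : ℕ → List (ℕ × ℕ × ℕ × ℕ)
quads m = concatMap (λ i → concatMap (λ j → concatMap (λ k → map (λ l → (i , j , k , l))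
            (range1 m)) (range1 m)) (range1 m)) (range1 m)

quadCount : Mat2 → ℕ → Vec2 → ℕ → ℕ
quadCount A N n m = length (filter (λ { (i , j , k , l) →
  Vec≡0mod? (n ·ᴹ ((((A ^ᴹ i) ⊖ (A ^ᴹ j)) ⊕ (A ^ᴹ k)) ⊖ (A ^ᴹ l))) N }) (quads m))

-- squarefree: no square of a prime divides N (in particular N ≠ 0)
Squarefree : ℕ → Set
Squarefree N = ∀ p → Prime p → ¬ (p ℕ.* p ND.∣ N)

ω : ℕ → ℕ
ω N = length (filter (λ p → prime? p ×-dec (p ∣? N)) (upTo (suc N)))

module Submission where

-- The matrices x I + y A form a copy of the quadratic ring ℤ[ξ], ξ² = τ ξ - 1 (Cayley–Hamilton),
-- in which A^i corresponds to the unit ξ^i of norm 1.  Put K = Q(n) (τ² - 4), where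
-- Q(n) = det (n ; n A) is a binary form of non-square discriminant τ² - 4, so K ≠ 0.  At a
-- prime p ∣ N with p ∤ K the congruence forces ξ^i - ξ^j + ξ^k - ξ^l ≡ 0, and four units of
-- norm 1 with this relation pair up: ξ^i ≡ ξ^j and ξ^k ≡ ξ^l, or ξ^i ≡ ξ^l and ξ^k ≡ ξ^j,
-- or ξ^k ≡ -ξ^i and ξ^l ≡ -ξ^j.  Sorting these primes into three classes by the case that
-- occurs gives at most 3^ω(N) colourings.  For each one, i is free and j, k, l are fixed
-- modulo the orders o₁, o₂₃, o′ of ξ at the primes of the first class, of the other two
-- classes, and of all of them; so there are at most ord (ord/o₁)(ord/o₂₃)(ord/o′) quadruples.
-- Now o′ ≤ o₁ o₂₃, and ord ≤ o′ e where ξ^e ≡ 1 modulo the product g ≤ |K| of the remaining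
-- primes of N with e ≤ g² (pigeonhole), so the count is at most ord² e² ≤ C |n|⁸ ord².

module Periods where

  open import Data.Nat as ℕ using (ℕ; zero; suc; _+_; _*_; _≤_; _<_; _≤?_; z≤n; s≤s; NonZero)
  open import Data.Nat.Properties using (anyUpTo?; ≮⇒≥; +-assoc; +-comm)
  open import Data.Nat.DivMod using (_/_; _%_; m%n<n; m≡m%n+[m/n]*n)
  open import Data.Nat.Divisibility using (_∣_; divides)
  open import Data.Nat.Induction using (<-rec)
  open import Data.Product using (∃; _×_; _,_; proj₁; proj₂)
  open import Data.Empty using (⊥-elim)
  open import Relation.Binary.PropositionalEquality
  open import Relation.Nullary using (¬_; Dec; yes; no)
  open import Relation.Nullary.Decidable using (_×-dec_)

  LeastPositive : (ℕ → Set) → ℕ → Set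
  LeastPositive P r = 1 ≤ r × P r × (∀ j → 1 ≤ j → j < r → ¬ P j)

  module _ {P : ℕ → Set} where

    least-positive : (∀ n → Dec (P n)) → ∀ n → 1 ≤ n → P n → ∃ (LeastPositive P)
    least-positive P? = <-rec _ search
      where
      search : ∀ n → (∀ {m} → m < n → 1 ≤ m → P m → ∃ (LeastPositive P)) → 1 ≤ n → P n → ∃ (LeastPositive P)
      search n smaller 1≤n Pn with anyUpTo? (λ j → (1 ≤? j) ×-dec P? j) n
      ... | yes (j , j<n , 1≤j , Pj) = smaller j<n 1≤j Pj
      ... | no none = n , 1≤n , Pn , λ j 1≤j j<n Pj → none (j , j<n , 1≤j , Pj)

    module _ {r : ℕ} (least : LeastPositive P r) where

      private
        instance
          r≢0 : NonZero r
          r≢0 = ℕ.>-nonZero (proj₁ least)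

      leastPositive-≤ : ∀ {s} → 1 ≤ s → P s → r ≤ s
      leastPositive-≤ 1≤s Ps = ≮⇒≥ λ s<r → proj₂ (proj₂ least) _ 1≤s s<r Ps

      leastPositive-∣ : (∀ k → P (r + k) → P k) → ∀ s → P s → r ∣ s
      leastPositive-∣ cancel s Ps = divides (s / r) (trans (m≡m%n+[m/n]*n s r) (cong (_+ s / r * r) remainder≡0))
        where
        strip : ∀ q t → P (q * r + t) → P t
        strip zero t Pt = Pt
        strip (suc q) t P[r+qr+t] = strip q t (cancel (q * r + t) (subst P (+-assoc r (q * r) t) P[r+qr+t]))
        P[s%r] : P (s % r)
        P[s%r] = strip (s / r) (s % r) (subst P (trans (m≡m%n+[m/n]*n s r) (+-comm (s % r) _)) Ps)
        remainder≡0 : s % r ≡ 0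
        remainder≡0 with s % r in eq
        ... | zero = refl
        ... | suc t = ⊥-elim (proj₂ (proj₂ least) (suc t) (s≤s z≤n) (subst (_< r) eq (m%n<n s r))
                                                 (subst P eq P[s%r]))

module Counting where

  open import Data.Nat as ℕ using (ℕ; suc; _+_; _*_; _∸_; _≤_; _<_; z≤n; s≤s; NonZero)
  open import Data.Nat.Properties
  open import Data.Nat.DivMod using (_/_; _%_; m≡m%n+[m/n]*n; [m+kn]%n≡m%n; m<n*o⇒m/o<n; m/n*n≡m)
  open import Data.Nat.Divisibility using (_∣_; divides)
  open import Data.Nat.ListAction using (sum)
  open import Data.List using (List; []; _∷_; _++_; length; filter; map; concatMap; upTo)
  open import Data.List.Properties using (filter-++; filter-none; length-++; length-filter; length-map; length-upTo)
  open import Data.List.Relation.Unary.All as All using (All; []; _∷_)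
  import Data.List.Relation.Unary.All.Properties as All
  open import Data.List.Relation.Unary.Any as Any using (Any; here; there)
  open import Data.List.Relation.Unary.AllPairs using ([]; _∷_)
  open import Data.List.Relation.Unary.Unique.Propositional using (Unique)
  import Data.List.Relation.Unary.Unique.Propositional.Properties as Unique
  open import Data.List.Membership.Propositional using (_∈_)
  open import Data.List.Membership.Propositional.Properties using (∈-filter⁺; ∈-filter⁻; ∈-upTo⁺; ∈-upTo⁻; ∈-map⁻)
  open import Data.List.Membership.Propositional.Properties.WithK using (unique∧set⇒bag)
  open import Data.List.Relation.Binary.BagAndSetEquality using (∼bag⇒↭)
  open import Data.List.Relation.Binary.Subset.Propositional using (_⊆_)
  open import Data.List.Relation.Binary.Permutation.Propositional.Properties using (↭-length)
  open import Data.Product using (∃; _×_; _,_; proj₂)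
  open import Data.Sum using (_⊎_; inj₁; inj₂)
  open import Data.Empty using (⊥-elim)
  open import Function using (_∘_)
  open import Function.Bundles using (_⇔_; mk⇔)
  open import Relation.Binary.Definitions using (DecidableEquality)
  open import Relation.Binary.PropositionalEquality
  open import Relation.Nullary using (¬_; yes; no)
  open import Relation.Nullary.Decidable using (_⊎-dec_)
  open import Relation.Unary using (Pred; Decidable)
  open import Level using (0ℓ)
  open import Defs using (range1)

  count : {A : Set} {P : Pred A 0ℓ} → Decidable P → List A → ℕ
  count P? xs = length (filter P? xs)

  module _ {A : Set} where

    module _ {P Q : Pred A 0ℓ} (P? : Decidable P) (Q? : Decidable Q) where

      count-mono : (∀ {x} → P x → Q x) → ∀ xs → count P? xs ≤ count Q? xs
      count-mono P⇒Q [] = z≤n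
      count-mono P⇒Q (x ∷ xs) with P? x | Q? x
      ... | yes _  | yes _  = s≤s (count-mono P⇒Q xs)
      ... | yes Px | no ¬Qx = ⊥-elim (¬Qx (P⇒Q Px))
      ... | no _   | yes _  = m≤n⇒m≤1+n (count-mono P⇒Q xs)
      ... | no _   | no _   = count-mono P⇒Q xs

    count-none : ∀ {P : Pred A 0ℓ} (P? : Decidable P) → (∀ x → ¬ P x) → ∀ xs → count P? xs ≡ 0
    count-none P? ¬P xs = cong length (filter-none P? {xs = xs} (All.tabulate λ {x} _ → ¬P x))

    count-map : ∀ {B : Set} {P : Pred B 0ℓ} (P? : Decidable P) (f : A → B) xs → count P? (map f xs) ≡ count (P? ∘ f) xs
    count-map P? f [] = refl
    count-map P? f (x ∷ xs) with P? (f x)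
    ... | yes _ = cong suc (count-map P? f xs)
    ... | no _ = count-map P? f xs

    module _ {B : Set} {P : Pred B 0ℓ} (P? : Decidable P) where

      count-++ : ∀ xs ys → count P? (xs ++ ys) ≡ count P? xs + count P? ys
      count-++ xs ys = trans (cong length (filter-++ P? xs ys)) (length-++ (filter P? xs))

      count-concatMap-≤ : ∀ {T : Pred A 0ℓ} (T? : Decidable T) (f : A → List B) {bound} →
        (∀ x → T x → count P? (f x) ≤ bound) → (∀ x → ¬ T x → count P? (f x) ≡ 0) →
        ∀ xs → count P? (concatMap f xs) ≤ count T? xs * bound
      count-concatMap-≤ T? f bounded empty [] = z≤n
      count-concatMap-≤ T? f bounded empty (x ∷ xs) with T? x
      ... | yes Tx = ≤-trans (≤-reflexive (count-++ (f x) (concatMap f xs)))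
                             (+-mono-≤ (bounded x Tx) (count-concatMap-≤ T? f bounded empty xs))
      ... | no ¬Tx = ≤-trans (≤-reflexive (trans (count-++ (f x) (concatMap f xs)) (cong (_+ _) (empty x ¬Tx))))
                             (count-concatMap-≤ T? f bounded empty xs)

      count-concatMap-≤-length : ∀ (f : A → List B) {bound} → (∀ x → count P? (f x) ≤ bound) →
        ∀ xs → count P? (concatMap f xs) ≤ length xs * bound
      count-concatMap-≤-length f bounded [] = z≤n
      count-concatMap-≤-length f bounded (x ∷ xs) =
        ≤-trans (≤-reflexive (count-++ (f x) (concatMap f xs))) (+-mono-≤ (bounded x) (count-concatMap-≤-length f bounded xs))

      count-concatMap-≡0 : ∀ (f : A → List B) → (∀ x → count P? (f x) ≡ 0) → ∀ xs → count P? (concatMap f xs) ≡ 0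
      count-concatMap-≡0 f empty [] = refl
      count-concatMap-≡0 f empty (x ∷ xs) =
        trans (count-++ (f x) (concatMap f xs)) (cong₂ _+_ (empty x) (count-concatMap-≡0 f empty xs))

    sum-map-≤ : ∀ (g : A → ℕ) {bound} xs → (∀ {x} → x ∈ xs → g x ≤ bound) → sum (map g xs) ≤ length xs * bound
    sum-map-≤ g [] bounded = z≤n
    sum-map-≤ g (x ∷ xs) bounded = +-mono-≤ (bounded (here refl)) (sum-map-≤ g xs (bounded ∘ there))

    count-∪ : ∀ {P Q : Pred A 0ℓ} (P? : Decidable P) (Q? : Decidable Q) xs →
      count (λ x → P? x ⊎-dec Q? x) xs ≤ count P? xs + count Q? xs
    count-∪ P? Q? [] = z≤n
    count-∪ P? Q? (x ∷ xs) with P? x | Q? x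
    ... | yes _ | yes _ = s≤s (≤-trans (count-∪ P? Q? xs) (+-monoʳ-≤ (count P? xs) (n≤1+n _)))
    ... | yes _ | no _  = s≤s (count-∪ P? Q? xs)
    ... | no _  | yes _ = ≤-trans (s≤s (count-∪ P? Q? xs)) (≤-reflexive (sym (+-suc (count P? xs) _)))
    ... | no _  | no _  = count-∪ P? Q? xs

    module _ {S : Set} {F : S → Pred A 0ℓ} (F? : ∀ s → Decidable (F s)) where

      count-any-≤-sum : ∀ ss xs → count (λ x → Any.any? (λ s → F? s x) ss) xs ≤ sum (map (λ s → count (F? s) xs) ss)
      count-any-≤-sum [] xs = ≤-reflexive (count-none _ (λ _ ()) xs)
      count-any-≤-sum (s ∷ ss) xs = begin
        count (λ x → Any.any? (λ s → F? s x) (s ∷ ss)) xs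
          ≤⟨ count-mono _ (λ x → F? s x ⊎-dec Any.any? (λ s → F? s x) ss) here-or-there xs ⟩
        count (λ x → F? s x ⊎-dec Any.any? (λ s → F? s x) ss) xs
          ≤⟨ count-∪ (F? s) (λ x → Any.any? (λ s → F? s x) ss) xs ⟩
        count (F? s) xs + count (λ x → Any.any? (λ s → F? s x) ss) xs
          ≤⟨ +-monoʳ-≤ (count (F? s) xs) (count-any-≤-sum ss xs) ⟩
        count (F? s) xs + sum (map (λ s → count (F? s) xs) ss) ∎
        where
        open ≤-Reasoning
        here-or-there : ∀ {x} → Any (λ s → F s x) (s ∷ ss) → F s x ⊎ Any (λ s → F s x) ss
        here-or-there (here Fx) = inj₁ Fx
        here-or-there (there any) = inj₂ any

  unique-map : ∀ {A B : Set} (f : A → B) {xs} → Unique xs →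
    (∀ {x y} → x ∈ xs → y ∈ xs → f x ≡ f y → x ≡ y) → Unique (map f xs)
  unique-map f {[]} [] injective = []
  unique-map f {x ∷ xs} (x∉xs ∷ unique) injective =
    All.map⁺ (All.tabulate λ y∈xs fx≡fy → All.lookup x∉xs y∈xs (injective (here refl) (there y∈xs) fx≡fy))
    ∷ unique-map f unique (λ x∈xs y∈xs → injective (there x∈xs) (there y∈xs))

  module _ {A : Set} (_≟_ : DecidableEquality A) where

    open import Data.List.Membership.DecPropositional _≟_ using (_∈?_)

    -- the elements of ys lying in xs form a duplicate-free list with the same elements as xs
    unique-⊆⇒length-≤ : ∀ {xs ys} → Unique xs → Unique ys → xs ⊆ ys → length xs ≤ length ys
    unique-⊆⇒length-≤ {xs} {ys} unique-xs unique-ys xs⊆ys = begin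
      length xs                   ≡⟨ ↭-length (∼bag⇒↭ (unique∧set⇒bag unique-xs (Unique.filter⁺ (_∈? xs) unique-ys) same)) ⟩
      length (filter (_∈? xs) ys) ≤⟨ length-filter (_∈? xs) ys ⟩
      length ys                   ∎
      where
      open ≤-Reasoning
      same : ∀ {x} → x ∈ xs ⇔ x ∈ filter (_∈? xs) ys
      same = mk⇔ (λ x∈xs → ∈-filter⁺ (_∈? xs) (xs⊆ys x∈xs) x∈xs) (λ x∈ → proj₂ (∈-filter⁻ (_∈? xs) {xs = ys} x∈))

  unique-<⇒length-≤ : ∀ {xs} m → Unique xs → All (_< m) xs → length xs ≤ m
  unique-<⇒length-≤ {xs} m unique bounded = begin
    length xs      ≤⟨ unique-⊆⇒length-≤ ℕ._≟_ unique (Unique.upTo⁺ m) (∈-upTo⁺ ∘ All.lookup bounded) ⟩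
    length (upTo m) ≡⟨ length-upTo m ⟩
    m              ∎
    where open ≤-Reasoning

  length-range1 : ∀ o → length (range1 o) ≡ o
  length-range1 o = trans (length-map suc (upTo o)) (length-upTo o)

  module _ {r : ℕ} .{{_ : NonZero r}} where

    same-quotient-and-residue : ∀ {i j} → j ≤ i → r ∣ i ∸ j → i / r ≡ j / r → i ≡ j
    same-quotient-and-residue {i} {j} j≤i (divides q i∸j≡qr) i/r≡j/r = begin
      i                 ≡⟨ m≡m%n+[m/n]*n i r ⟩
      i % r + i / r * r ≡⟨ cong₂ (λ u v → u + v * r) same-residue i/r≡j/r ⟩
      j % r + j / r * r ≡⟨ sym (m≡m%n+[m/n]*n j r) ⟩
      j                 ∎
      where
      open ≡-Reasoning
      same-residue : i % r ≡ j % r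
      same-residue = trans (cong (_% r) (trans (sym (m+[n∸m]≡n j≤i)) (cong (j +_) i∸j≡qr))) ([m+kn]%n≡m%n j q r)

    -- the elements of [1, o] in a fixed residue class modulo r lie in distinct blocks of length r
    count-residue-class-≤ : ∀ {T : Pred ℕ 0ℓ} (T? : Decidable T) o → r ∣ o →
      (∀ {x y} → T x → T y → y ≤ x → r ∣ x ∸ y) → count T? (range1 o) ≤ o / r
    count-residue-class-≤ {T} T? o r∣o congruent = begin
      length L              ≡⟨ sym (length-map block L) ⟩
      length (map block L)  ≤⟨ unique-<⇒length-≤ (o / r) (unique-map block unique-L injective)
                                                     (All.map⁺ (All.tabulate block<)) ⟩
      o / r                 ∎
      where
      open ≤-Reasoning
      L = filter T? (range1 o)
      block : ℕ → ℕ
      block x = ℕ.pred x / r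
      unique-L : Unique L
      unique-L = Unique.filter⁺ T? (Unique.map⁺ suc-injective (Unique.upTo⁺ o))
      view : ∀ {x} → x ∈ L → ∃ λ i → x ≡ suc i × i < o × T x
      view x∈L with ∈-filter⁻ T? {xs = range1 o} x∈L
      ... | x∈range , Tx with ∈-map⁻ suc x∈range
      ...   | i , i∈upTo , refl = i , refl , ∈-upTo⁻ i∈upTo , Tx
      block< : ∀ {x} → x ∈ L → block x < o / r
      block< x∈L with view x∈L
      ... | i , refl , i<o , _ = m<n*o⇒m/o<n (subst (i <_) (sym (m/n*n≡m r∣o)) i<o)
      injective : ∀ {x y} → x ∈ L → y ∈ L → block x ≡ block y → x ≡ y
      injective x∈L y∈L same-block with view x∈L | view y∈L
      ... | i , refl , _ , Tx | j , refl , _ , Ty with ≤-total j i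
      ...   | inj₁ j≤i = cong suc (same-quotient-and-residue j≤i (congruent Tx Ty (s≤s j≤i)) same-block)
      ...   | inj₂ i≤j = cong suc (sym (same-quotient-and-residue i≤j (congruent Ty Tx (s≤s i≤j)) (sym same-block)))

module Colourings where

  open import Data.Nat using (_+_; _*_; _^_)
  open import Data.Nat.Properties using (*-suc)
  open import Data.List using (List; []; _∷_; _++_; [_]; length; concatMap)
  open import Data.List.Properties using (++-assoc)
  open import Data.List.Relation.Unary.All using (All; []; _∷_)
  open import Data.List.Relation.Unary.Any as Any using (Any; here; there)
  open import Data.List.Relation.Unary.Any.Properties using (concatMap⁺)
  open import Data.List.Membership.Propositional using (_∈_; find)
  open import Data.List.Membership.Propositional.Properties using (∈-concatMap⁻)
  open import Data.List.Relation.Binary.Permutation.Propositional using (_↭_; ↭-refl; prep; ↭-trans)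
  open import Data.List.Relation.Binary.Permutation.Propositional.Properties using (shift)
  open import Data.Product using (_×_; _,_)
  open import Data.Sum using (_⊎_; inj₁; inj₂)
  open import Relation.Binary.PropositionalEquality hiding ([_])
  open import Relation.Unary using (Pred)
  open import Level using (0ℓ)

  Split : Set → Set
  Split A = List A × List A × List A

  module _ {A : Set} where

    extend : A → Split A → List (Split A)
    extend p (a , b , c) = (p ∷ a , b , c) ∷ (a , p ∷ b , c) ∷ (a , b , p ∷ c) ∷ []

    splits : List A → List (Split A)
    splits [] = [ ([] , [] , []) ]
    splits (p ∷ ps) = concatMap (extend p) (splits ps)

    length-splits : ∀ ps → length (splits ps) ≡ 3 ^ length ps
    length-splits [] = refl
    length-splits (p ∷ ps) = trans (length-extend (splits ps)) (cong (3 *_) (length-splits ps))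
      where
      length-extend : ∀ ss → length (concatMap (extend p) ss) ≡ 3 * length ss
      length-extend [] = refl
      length-extend (s ∷ ss) = trans (cong (3 +_) (length-extend ss)) (sym (*-suc 3 (length ss)))

    splits-↭ : ∀ {ps a b c} → (a , b , c) ∈ splits ps → a ++ b ++ c ↭ ps
    splits-↭ {[]} (here refl) = ↭-refl
    splits-↭ {p ∷ ps} s∈ with find (∈-concatMap⁻ (extend p) {xs = splits ps} s∈)
    ... | (a , b , c) , s∈splits , here refl = prep p (splits-↭ s∈splits)
    ... | (a , b , c) , s∈splits , there (here refl) = ↭-trans (shift p a (b ++ c)) (prep p (splits-↭ s∈splits))
    ... | (a , b , c) , s∈splits , there (there (here refl)) =
      ↭-trans (subst₂ _↭_ (++-assoc a b (p ∷ c)) (cong (p ∷_) (++-assoc a b c)) (shift p (a ++ b) c))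
              (prep p (splits-↭ s∈splits))

    module _ {C₁ C₂ C₃ : Pred A 0ℓ} where

      Colouring : Split A → Set
      Colouring (a , b , c) = All C₁ a × All C₂ b × All C₃ c

      colouring-exists : ∀ ps → All (λ p → C₁ p ⊎ C₂ p ⊎ C₃ p) ps → Any Colouring (splits ps)
      colouring-exists [] [] = here ([] , [] , [])
      colouring-exists (p ∷ ps) (Cp ∷ Cps) = concatMap⁺ (extend p) (Any.map (place Cp) (colouring-exists ps Cps))
        where
        place : C₁ p ⊎ C₂ p ⊎ C₃ p → ∀ {s} → Colouring s → Any Colouring (extend p s)
        place (inj₁ C₁p)        (a , b , c) = here (C₁p ∷ a , b , c)
        place (inj₂ (inj₁ C₂p)) (a , b , c) = there (here (a , C₂p ∷ b , c))
        place (inj₂ (inj₂ C₃p)) (a , b , c) = there (there (here (a , b , C₃p ∷ c)))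

module Arithmetic where

  open import Data.Nat as ℕ using (ℕ; zero; suc; _*_; _≤_; _<_; NonZero)
  open import Data.Nat.Properties
  open import Data.Nat.Divisibility
  open import Data.Nat.DivMod using (_/_; m/n*n≡m; m*[n/m]≡n)
  open import Data.Nat.GCD using (gcd; gcd[m,n]∣m; gcd[m,n]∣n; gcd[m,n]≢0)
  open import Data.Nat.Coprimality as Coprime using (Coprime; coprime-/gcd; coprime-divisor)
  open import Data.Nat.Primality using (Prime; euclidsLemma)
  open import Data.Nat.Primality.Factorisation using (factorisationHasAllPrimeFactors)
  open import Data.Nat.ListAction using (product)
  open import Data.Nat.ListAction.Properties using (∈⇒∣product)
  open import Data.Nat.Solver using (module +-*-Solver)
  open import Data.Integer as ℤ using (+_)
  import Data.Integer.Properties as ℤ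
  import Data.Integer.Divisibility.Signed as ℤ∣
  open import Data.List using ([]; _∷_)
  open import Data.List.Membership.Propositional using (_∈_)
  open import Data.List.Relation.Unary.All as All using (All; []; _∷_)
  open import Data.List.Relation.Unary.AllPairs using ([]; _∷_)
  open import Data.List.Relation.Unary.Unique.Propositional using (Unique)
  open import Data.Product using (_,_)
  open import Data.Sum using (_⊎_; inj₁; inj₂)
  open import Data.Empty using (⊥-elim)
  open import Relation.Binary.PropositionalEquality
  open import Relation.Nullary using (¬_)
  open import Defs using (Squarefree)

  open +-*-Solver using (solve; _:*_; _:=_)

  product-∣ : ∀ {m ps} → Unique ps → All Prime ps → All (_∣ m) ps → product ps ∣ m
  product-∣ {ps = []} _ _ _ = 1∣ _
  product-∣ {m} {p ∷ ps} (p∉ps ∷ unique) (p-prime ∷ primes) (p∣m ∷ ps∣m) =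
    divides (quotient p∣q) (begin
      m                             ≡⟨ m∣n⇒n≡quotient*m Πps∣m ⟩
      q * product ps                ≡⟨ cong (_* product ps) (m∣n⇒n≡quotient*m p∣q) ⟩
      quotient p∣q * p * product ps ≡⟨ *-assoc (quotient p∣q) p (product ps) ⟩
      quotient p∣q * (p * product ps) ∎)
    where
    open ≡-Reasoning
    Πps∣m = product-∣ unique primes ps∣m
    q = quotient Πps∣m
    p∤Πps : ¬ p ∣ product ps
    p∤Πps p∣Πps = All.lookup p∉ps (factorisationHasAllPrimeFactors p-prime p∣Πps primes) refl
    p∣q : p ∣ q
    p∣q with euclidsLemma q (product ps) p-prime (subst (p ∣_) (m∣n⇒n≡quotient*m Πps∣m) p∣m)
    ... | inj₁ p∣q = p∣q
    ... | inj₂ p∣Πps = ⊥-elim (p∤Πps p∣Πps)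

  squarefree⇒unique : ∀ ps → All Prime ps → Squarefree (product ps) → Unique ps
  squarefree⇒unique [] [] _ = []
  squarefree⇒unique (p ∷ ps) (p-prime ∷ primes) squarefree =
    All.tabulate (λ p∈ps p≡p → squarefree p p-prime (*-monoʳ-∣ p (∈⇒∣product (subst (_∈ ps) (sym p≡p) p∈ps))))
    ∷ squarefree⇒unique ps primes (λ q prime-q q²∣Πps → squarefree q prime-q (∣n⇒∣m*n p q²∣Πps))

  cancel-square : ∀ D y w g .{{_ : NonZero g}} → D * ((y * g) * (y * g)) ≡ (w * g) * (w * g) → D * (y * y) ≡ w * w
  cancel-square D y w g eq = *-cancelʳ-≡ _ _ (g * g) {{m*n≢0 g g}} (begin
    D * (y * y) * (g * g)     ≡⟨ solve 3 (λ D y g → D :* (y :* y) :* (g :* g) := D :* ((y :* g) :* (y :* g))) refl D y g ⟩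
    D * ((y * g) * (y * g))   ≡⟨ eq ⟩
    (w * g) * (w * g)         ≡⟨ solve 2 (λ w g → (w :* g) :* (w :* g) := w :* w :* (g :* g)) refl w g ⟩
    w * w * (g * g)           ∎)
    where open ≡-Reasoning

  -- write w / y in lowest terms w′ / y′: then y′ ∣ w′² forces y′ = 1, so D would be the square w′²
  nonsquare-irrational : ∀ {s D y w} → s * s < D → D < suc s * suc s → D * (y * y) ≡ w * w → y ≡ 0
  nonsquare-irrational {y = zero} _ _ _ = refl
  nonsquare-irrational {s} {D} {y@(suc _)} {w} s²<D D<[s+1]² D*y²≡w² =
    ⊥-elim (<⇒≱ s<w′ (≤-pred w′<s+1))
    where
    g = gcd w y
    instance
      g≢0 : NonZero g
      g≢0 = ℕ.≢-nonZero (gcd[m,n]≢0 w y (inj₂ λ ()))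
    w′ = w / g
    y′ = y / g
    coprime : Coprime w′ y′
    coprime = coprime-/gcd w y
    lowest-terms : D * (y′ * y′) ≡ w′ * w′
    lowest-terms = cancel-square D y′ w′ g (subst₂ (λ u v → D * (u * u) ≡ v * v)
                     (sym (m/n*n≡m (gcd[m,n]∣n w y))) (sym (m/n*n≡m (gcd[m,n]∣m w y))) D*y²≡w²)
    y′≡1 : y′ ≡ 1
    y′≡1 = coprime (coprime-divisor (Coprime.sym coprime) (divides (D * y′) (trans (sym lowest-terms) (sym (*-assoc D y′ y′)))) , ∣-refl)
    D≡w′² : D ≡ w′ * w′
    D≡w′² = trans (sym (trans (cong (λ u → D * (u * u)) y′≡1) (*-identityʳ D))) lowest-terms
    s<w′ : s < w′
    s<w′ = ≰⇒> λ w′≤s → <⇒≱ s²<D (subst (_≤ s * s) (sym D≡w′²) (*-mono-≤ w′≤s w′≤s))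
    w′<s+1 : w′ < suc s
    w′<s+1 = ≰⇒> λ s+1≤w′ → <⇒≱ D<[s+1]² (subst (suc s * suc s ≤_) (sym D≡w′²) (*-mono-≤ s+1≤w′ s+1≤w′))

  module _ {p : ℕ} (p-prime : Prime p) where

    euclidsLemmaℤ : ∀ x y → + p ℤ∣.∣ x ℤ.* y → + p ℤ∣.∣ x ⊎ + p ℤ∣.∣ y
    euclidsLemmaℤ x y p∣xy with euclidsLemma ℤ.∣ x ∣ ℤ.∣ y ∣ p-prime (subst (p ∣_) (ℤ.abs-* x y) (ℤ∣.∣⇒∣ᵤ p∣xy))
    ... | inj₁ p∣x = inj₁ (ℤ∣.∣ᵤ⇒∣ p∣x)
    ... | inj₂ p∣y = inj₂ (ℤ∣.∣ᵤ⇒∣ p∣y)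

    euclidsLemmaℤ-square : ∀ x → + p ℤ∣.∣ x ℤ.* x → + p ℤ∣.∣ x
    euclidsLemmaℤ-square x p∣x² with euclidsLemmaℤ x x p∣x²
    ... | inj₁ p∣x = p∣x
    ... | inj₂ p∣x = p∣x

  -- (o / r₁)(o / r₂) ≤ o (o / r) because r ≤ r₁ r₂, and o / r ≤ e because o ≤ r e
  quotients-≤ : ∀ {o r₁ r₂ r e} .{{_ : NonZero r₁}} .{{_ : NonZero r₂}} .{{_ : NonZero r}} →
    r₁ ∣ o → r₂ ∣ o → r ∣ o → r ≤ r₁ * r₂ → o ≤ r * e →
    o * (o / r₁ * (o / r₂ * (o / r))) ≤ (o * o) * (e * e)
  quotients-≤ {o} {r₁} {r₂} {r} {e} r₁∣o r₂∣o r∣o r≤r₁r₂ o≤re = begin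
    o * (q₁ * (q₂ * q)) ≡⟨ cong (o *_) (sym (*-assoc q₁ q₂ q)) ⟩
    o * (q₁ * q₂ * q)   ≤⟨ *-monoʳ-≤ o (*-mono-≤ q₁q₂≤oq q≤e) ⟩
    o * (o * q * e)     ≤⟨ *-monoʳ-≤ o (*-monoˡ-≤ e (*-monoʳ-≤ o q≤e)) ⟩
    o * (o * e * e)     ≡⟨ solve 2 (λ o e → o :* (o :* e :* e) := o :* o :* (e :* e)) refl o e ⟩
    o * o * (e * e)     ∎
    where
    open ≤-Reasoning
    q₁ = o / r₁
    q₂ = o / r₂
    q = o / r
    q≤e : q ≤ e
    q≤e = *-cancelˡ-≤ r (≤-trans (≤-reflexive (m*[n/m]≡n r∣o)) o≤re)
    q₁q₂≤oq : q₁ * q₂ ≤ o * q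
    q₁q₂≤oq = *-cancelʳ-≤ _ _ (r₁ * r₂) {{m*n≢0 r₁ r₂}} (begin
      q₁ * q₂ * (r₁ * r₂)   ≡⟨ solve 4 (λ q₁ q₂ r₁ r₂ → q₁ :* q₂ :* (r₁ :* r₂) := (r₁ :* q₁) :* (r₂ :* q₂)) refl q₁ q₂ r₁ r₂ ⟩
      (r₁ * q₁) * (r₂ * q₂) ≡⟨ cong₂ _*_ (m*[n/m]≡n r₁∣o) (m*[n/m]≡n r₂∣o) ⟩
      o * o                 ≡⟨ cong (o *_) (sym (m*[n/m]≡n r∣o)) ⟩
      o * (r * q)           ≡⟨ solve 3 (λ o r q → o :* (r :* q) := o :* q :* r) refl o r q ⟩
      o * q * r             ≤⟨ *-monoʳ-≤ (o * q) r≤r₁r₂ ⟩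
      o * q * (r₁ * r₂)     ∎)

module Discriminant where

  open import Data.Nat as ℕ using (ℕ; suc; _<_; _∸_; z≤n)
  import Data.Nat.Properties as ℕ
  open import Data.Nat.Properties using (m+[n∸m]≡n)
  open import Data.Integer as ℤ using (ℤ; +_; _+_; _*_; _-_; -_)
  import Data.Integer.Properties as ℤ
  open import Data.Product using (∃; _×_; _,_)
  open import Data.List using (_∷_; [])
  open import Relation.Binary.PropositionalEquality
  import Data.Integer.Tactic.RingSolver as ℤ-Solver

  square-abs : ∀ i → i * i ≡ + (ℤ.∣ i ∣ ℕ.* ℤ.∣ i ∣)
  square-abs (+ n) = sym (ℤ.pos-* n n)
  square-abs ℤ.-[1+ n ] = refl

  disc-between-squares : ∀ τ → 2 < ℤ.∣ τ ∣ → ∃ λ s → s ℕ.* s < ℤ.∣ τ * τ - + 4 ∣ × ℤ.∣ τ * τ - + 4 ∣ < suc s ℕ.* suc s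
  disc-between-squares τ 2<∣τ∣ = between (ℤ.∣ τ ∣ ∸ 3) (sym (m+[n∸m]≡n 2<∣τ∣))
    where
    open import Data.Nat.Solver using (module +-*-Solver)
    open +-*-Solver
    between : ∀ u → ℤ.∣ τ ∣ ≡ 3 ℕ.+ u → ∃ λ s → s ℕ.* s < ℤ.∣ τ * τ - + 4 ∣ × ℤ.∣ τ * τ - + 4 ∣ < suc s ℕ.* suc s
    between u ∣τ∣≡3+u = 2 ℕ.+ u , subst (_ <_) (sym ∣disc∣≡) below , subst (_< _) (sym ∣disc∣≡) above
      where
      t² : ℤ.∣ τ ∣ ℕ.* ℤ.∣ τ ∣ ≡ (u ℕ.* u ℕ.+ 6 ℕ.* u ℕ.+ 5) ℕ.+ 4
      t² = trans (cong (λ t → t ℕ.* t) ∣τ∣≡3+u)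
                 (solve 1 (λ u → (con 3 :+ u) :* (con 3 :+ u) := (u :* u :+ con 6 :* u :+ con 5) :+ con 4) refl u)
      ∣disc∣≡ : ℤ.∣ τ * τ - + 4 ∣ ≡ u ℕ.* u ℕ.+ 6 ℕ.* u ℕ.+ 5
      ∣disc∣≡ = cong ℤ.∣_∣ (begin
        τ * τ - + 4                                   ≡⟨ cong (_- + 4) (trans (square-abs τ) (cong +_ t²)) ⟩
        + ((u ℕ.* u ℕ.+ 6 ℕ.* u ℕ.+ 5) ℕ.+ 4) - + 4   ≡⟨ cong (_- + 4) (ℤ.pos-+ (u ℕ.* u ℕ.+ 6 ℕ.* u ℕ.+ 5) 4) ⟩
        + (u ℕ.* u ℕ.+ 6 ℕ.* u ℕ.+ 5) + + 4 - + 4     ≡⟨ +4-4 (+ (u ℕ.* u ℕ.+ 6 ℕ.* u ℕ.+ 5)) ⟩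
        + (u ℕ.* u ℕ.+ 6 ℕ.* u ℕ.+ 5)                 ∎)
        where
        open ≡-Reasoning
        +4-4 : ∀ k → k + + 4 - + 4 ≡ k
        +4-4 k = ℤ-Solver.solve (k ∷ [])
      below : (2 ℕ.+ u) ℕ.* (2 ℕ.+ u) < u ℕ.* u ℕ.+ 6 ℕ.* u ℕ.+ 5
      below = subst₂ _<_ (solve 1 (λ u → u :* u :+ con 4 :* u :+ con 4 := (con 2 :+ u) :* (con 2 :+ u)) refl u)
                         (solve 1 (λ u → u :* u :+ con 4 :* u :+ con 4 :+ (con 1 :+ con 2 :* u) := u :* u :+ con 6 :* u :+ con 5) refl u)
                         (ℕ.m<m+n (u ℕ.* u ℕ.+ 4 ℕ.* u ℕ.+ 4) (ℕ.s≤s z≤n))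
      above : u ℕ.* u ℕ.+ 6 ℕ.* u ℕ.+ 5 < suc (2 ℕ.+ u) ℕ.* suc (2 ℕ.+ u)
      above = subst (u ℕ.* u ℕ.+ 6 ℕ.* u ℕ.+ 5 <_)
                (solve 1 (λ u → u :* u :+ con 6 :* u :+ con 5 :+ con 4 := (con 3 :+ u) :* (con 3 :+ u)) refl u)
                (ℕ.m<m+n (u ℕ.* u ℕ.+ 6 ℕ.* u ℕ.+ 5) (ℕ.s≤s z≤n))

module Quadratic where

  open import Data.Nat as ℕ using (ℕ; zero; suc; _≤_; _<_; _∸_; NonZero)
  open import Data.Nat.Properties using (m+[n∸m]≡n; m<n⇒0<n∸m; m∸n≤m; <⇒≤; ≤-trans; ≤-pred; n<1+n)
  open import Data.Nat.Primality using (Prime)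
  open import Data.Nat.ListAction using (product)
  open import Data.List.Relation.Unary.Unique.Propositional using (Unique)
  import Data.Nat.Divisibility as ℕ∣
  open import Data.Integer as ℤ using (ℤ; +_; _+_; _*_; _-_; -_)
  import Data.Integer.Properties as ℤ
  open import Data.Integer.Divisibility.Signed
    using (_∣_; _∣?_; divides; ∣ᵤ⇒∣; ∣⇒∣ᵤ; ∣m∣n⇒∣m+n; ∣m∣n⇒∣m-n; ∣m⇒∣-m; ∣n⇒∣m*n; ∣m⇒∣m*n; ∣-trans)
  open import Data.Integer.DivMod using (_%ℕ_; _/ℕ_; n%ℕd<d; a≡a%ℕn+[a/ℕn]*n)
  open import Data.Integer.Tactic.RingSolver using (solve; solve-∀)
  open import Data.Fin using (Fin; toℕ; fromℕ<; combine)
  open import Data.Fin.Properties using (pigeonhole; fromℕ<-injective; combine-injective; toℕ<n)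
  open import Data.List using (List; []; _∷_)
  open import Data.List.Relation.Unary.All as All using (All)
  open import Data.Product using (∃; _×_; _,_; proj₁; proj₂)
  open import Data.Sum using (_⊎_; [_,_]′)
  import Data.Sum as Sum
  open import Data.Empty using (⊥-elim)
  open import Function using (_∘_)
  open import Relation.Binary.PropositionalEquality
  open import Relation.Nullary using (¬_; Dec)
  open import Relation.Nullary.Decidable using (_×-dec_; map′)
  open Arithmetic using (euclidsLemmaℤ; euclidsLemmaℤ-square; product-∣)
  open Periods using (LeastPositive; leastPositive-∣)

  ≡-%ℕ⇒∣- : ∀ {g} .{{_ : NonZero g}} a b → a %ℕ g ≡ b %ℕ g → + g ∣ a - b
  ≡-%ℕ⇒∣- {g} a b same = divides (a /ℕ g - b /ℕ g) (begin
    a - b                                                      ≡⟨ cong₂ _-_ (a≡a%ℕn+[a/ℕn]*n a g) (a≡a%ℕn+[a/ℕn]*n b g) ⟩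
    (+ (a %ℕ g) + a /ℕ g * + g) - (+ (b %ℕ g) + b /ℕ g * + g)  ≡⟨ cong (λ r → (+ (a %ℕ g) + a /ℕ g * + g) - (+ r + b /ℕ g * + g)) (sym same) ⟩
    (+ (a %ℕ g) + a /ℕ g * + g) - (+ (a %ℕ g) + b /ℕ g * + g)  ≡⟨ cancel (+ (a %ℕ g)) (a /ℕ g) (b /ℕ g) (+ g) ⟩
    (a /ℕ g - b /ℕ g) * + g                                    ∎)
    where
    open ≡-Reasoning
    cancel : ∀ r q q′ g → (r + q * g) - (r + q′ * g) ≡ (q - q′) * g
    cancel r q q′ g = solve (r ∷ q ∷ q′ ∷ g ∷ [])

  module QuadraticRing (τ : ℤ) where

    -- ⟨ a , b ⟩ is a + b ξ with ξ² = τ ξ - 1.  Without η, case splits on ⟨_,_⟩ reduce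
    -- products to explicit integer polynomials, which the ring solver can then compare.
    record R : Set where
      no-eta-equality
      pattern
      constructor ⟨_,_⟩
      field
        re im : ℤ

    open R public

    infixl 6 _⊞_ _⊟_
    infixl 7 _⊠_

    _⊞_ _⊟_ _⊠_ : R → R → R
    ⟨ a , b ⟩ ⊞ ⟨ c , d ⟩ = ⟨ a + c , b + d ⟩
    ⟨ a , b ⟩ ⊟ ⟨ c , d ⟩ = ⟨ a - c , b - d ⟩
    ⟨ a , b ⟩ ⊠ ⟨ c , d ⟩ = ⟨ a * c - b * d , a * d + b * c + τ * b * d ⟩

    neg : R → R
    neg ⟨ a , b ⟩ = ⟨ - a , - b ⟩

    ι : ℤ → R
    ι n = ⟨ n , + 0 ⟩

    1ᴿ ξ : R
    1ᴿ = ι (+ 1)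
    ξ = ⟨ + 0 , + 1 ⟩

    ξ^_ : ℕ → R
    ξ^ zero = 1ᴿ
    ξ^ suc i = ξ ⊠ ξ^ i

    conj : R → R
    conj ⟨ a , b ⟩ = ⟨ a + τ * b , - b ⟩

    norm trace : R → ℤ
    norm ⟨ a , b ⟩ = a * a + τ * a * b + b * b
    trace ⟨ a , b ⟩ = + 2 * a + τ * b

    disc : ℤ
    disc = τ * τ - + 4

    ⊠-comm : ∀ X Y → X ⊠ Y ≡ Y ⊠ X
    ⊠-comm ⟨ a , b ⟩ ⟨ c , d ⟩ = cong₂ ⟨_,_⟩ (solve (a ∷ b ∷ c ∷ d ∷ [])) (solve (a ∷ b ∷ c ∷ d ∷ τ ∷ []))

    ⊠-assoc : ∀ X Y Z → X ⊠ Y ⊠ Z ≡ X ⊠ (Y ⊠ Z)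
    ⊠-assoc ⟨ a , b ⟩ ⟨ c , d ⟩ ⟨ e , f ⟩ =
      cong₂ ⟨_,_⟩ (solve (a ∷ b ∷ c ∷ d ∷ e ∷ f ∷ τ ∷ [])) (solve (a ∷ b ∷ c ∷ d ∷ e ∷ f ∷ τ ∷ []))

    1ᴿ-⊠ : ∀ X → 1ᴿ ⊠ X ≡ X
    1ᴿ-⊠ ⟨ a , b ⟩ = cong₂ ⟨_,_⟩ (solve (a ∷ b ∷ [])) (solve (a ∷ b ∷ τ ∷ []))

    ⊠-1ᴿ : ∀ X → X ⊠ 1ᴿ ≡ X
    ⊠-1ᴿ X = trans (⊠-comm X 1ᴿ) (1ᴿ-⊠ X)

    ⊠-⊟-distribˡ : ∀ Z X Y → Z ⊠ (X ⊟ Y) ≡ Z ⊠ X ⊟ Z ⊠ Y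
    ⊠-⊟-distribˡ ⟨ a , b ⟩ ⟨ c , d ⟩ ⟨ e , f ⟩ =
      cong₂ ⟨_,_⟩ (solve (a ∷ b ∷ c ∷ d ∷ e ∷ f ∷ [])) (solve (a ∷ b ∷ c ∷ d ∷ e ∷ f ∷ τ ∷ []))

    ⊟-self : ∀ X → X ⊟ X ≡ ι (+ 0)
    ⊟-self ⟨ a , b ⟩ = cong₂ ⟨_,_⟩ (solve (a ∷ [])) (solve (b ∷ []))

    neg-⊟ : ∀ X Y → neg (X ⊟ Y) ≡ Y ⊟ X
    neg-⊟ ⟨ a , b ⟩ ⟨ c , d ⟩ = cong₂ ⟨_,_⟩ (solve (a ∷ c ∷ [])) (solve (b ∷ d ∷ []))

    ⊟-⊞-⊟ : ∀ X Y Z → (X ⊟ Y) ⊞ (Y ⊟ Z) ≡ X ⊟ Z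
    ⊟-⊞-⊟ ⟨ a , b ⟩ ⟨ c , d ⟩ ⟨ e , f ⟩ = cong₂ ⟨_,_⟩ (solve (a ∷ c ∷ e ∷ [])) (solve (b ∷ d ∷ f ∷ []))

    ⊞-as-⊟-neg : ∀ X Y → X ⊞ Y ≡ Y ⊟ neg X
    ⊞-as-⊟-neg ⟨ a , b ⟩ ⟨ c , d ⟩ = cong₂ ⟨_,_⟩ (solve (a ∷ c ∷ [])) (solve (b ∷ d ∷ []))

    ⊠-conj : ∀ X → X ⊠ conj X ≡ ι (norm X)
    ⊠-conj ⟨ a , b ⟩ = cong₂ ⟨_,_⟩ (real-part a b τ) (solve (a ∷ b ∷ τ ∷ []))
      where
      real-part : ∀ a b τ → a * (a + τ * b) - b * - b ≡ a * a + τ * a * b + b * b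
      real-part = solve-∀

    norm-⊠ : ∀ X Y → norm (X ⊠ Y) ≡ norm X * norm Y
    norm-⊠ ⟨ a , b ⟩ ⟨ c , d ⟩ = multiplicative a b c d τ
      where
      multiplicative : ∀ a b c d τ → let x = a * c - b * d; y = a * d + b * c + τ * b * d in
        x * x + τ * x * y + y * y ≡ (a * a + τ * a * b + b * b) * (c * c + τ * c * d + d * d)
      multiplicative = solve-∀

    norm-neg : ∀ X → norm (neg X) ≡ norm X
    norm-neg ⟨ a , b ⟩ = even a b τ
      where
      even : ∀ a b τ → - a * - a + τ * - a * - b + - b * - b ≡ a * a + τ * a * b + b * b
      even = solve-∀

    norm-conj : ∀ X → norm (conj X) ≡ norm X
    norm-conj ⟨ a , b ⟩ = invariant a b τ
      where
      invariant : ∀ a b τ → (a + τ * b) * (a + τ * b) + τ * (a + τ * b) * - b + - b * - b ≡ a * a + τ * a * b + b * b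
      invariant = solve-∀

    disc-trace-norm : ∀ X → disc * (im X * im X) ≡ trace X * trace X - + 4 * norm X
    disc-trace-norm ⟨ a , b ⟩ = identity a b τ
      where
      identity : ∀ a b τ → (τ * τ - + 4) * (b * b) ≡ (+ 2 * a + τ * b) * (+ 2 * a + τ * b) - + 4 * (a * a + τ * a * b + b * b)
      identity = solve-∀

    re²-norm : ∀ X → re X * re X ≡ norm X - im X * (τ * re X + im X)
    re²-norm ⟨ a , b ⟩ = identity a b τ
      where
      identity : ∀ a b τ → a * a ≡ (a * a + τ * a * b + b * b) - b * (τ * a + b)
      identity = solve-∀

    trace-conj-⊠-⊟ : ∀ U V → trace (conj V ⊠ (U ⊟ V)) ≡ norm U - norm V - norm (U ⊟ V)
    trace-conj-⊠-⊟ ⟨ a , b ⟩ ⟨ c , d ⟩ = identity a b c d τ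
      where
      identity : ∀ a b c d τ → let x = a - c; y = b - d in
        + 2 * ((c + τ * d) * x - - d * y) + τ * ((c + τ * d) * y + - d * x + τ * - d * y)
          ≡ (a * a + τ * a * b + b * b) - (c * c + τ * c * d + d * d) - (x * x + τ * x * y + y * y)
      identity = solve-∀

    cross-term-expand : ∀ X₁ X₂ X₃ X₄ → (X₂ ⊠ X₄ ⊟ X₁ ⊠ X₃) ⊠ conj (X₂ ⊞ X₄) ≡
      (X₂ ⊠ X₄ ⊠ conj (X₂ ⊞ X₄) ⊟ (X₂ ⊞ X₄)) ⊟ (X₁ ⊠ X₃ ⊠ conj (X₁ ⊞ X₃) ⊟ (X₁ ⊞ X₃))
      ⊞ (X₁ ⊠ X₃ ⊠ conj (X₁ ⊟ X₂ ⊞ X₃ ⊟ X₄) ⊟ (X₁ ⊟ X₂ ⊞ X₃ ⊟ X₄))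
    cross-term-expand ⟨ a , b ⟩ ⟨ c , d ⟩ ⟨ e , f ⟩ ⟨ g , h ⟩ =
      cong₂ ⟨_,_⟩ (solve (a ∷ b ∷ c ∷ d ∷ e ∷ f ∷ g ∷ h ∷ τ ∷ [])) (solve (a ∷ b ∷ c ∷ d ∷ e ∷ f ∷ g ∷ h ∷ τ ∷ []))

    four-term-factor : ∀ X₁ X₂ X₃ X₄ → X₁ ⊠ (X₁ ⊟ X₂ ⊞ X₃ ⊟ X₄) ⊞ (X₂ ⊠ X₄ ⊟ X₁ ⊠ X₃) ≡ (X₁ ⊟ X₂) ⊠ (X₁ ⊟ X₄)
    four-term-factor ⟨ a , b ⟩ ⟨ c , d ⟩ ⟨ e , f ⟩ ⟨ g , h ⟩ =
      cong₂ ⟨_,_⟩ (solve (a ∷ b ∷ c ∷ d ∷ e ∷ f ∷ g ∷ h ∷ [])) (solve (a ∷ b ∷ c ∷ d ∷ e ∷ f ∷ g ∷ h ∷ τ ∷ []))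

    four-term-⊟ˡ : ∀ X₁ X₂ X₃ X₄ → (X₁ ⊟ X₂ ⊞ X₃ ⊟ X₄) ⊟ (X₁ ⊟ X₂) ≡ X₃ ⊟ X₄
    four-term-⊟ˡ ⟨ a , b ⟩ ⟨ c , d ⟩ ⟨ e , f ⟩ ⟨ g , h ⟩ = cong₂ ⟨_,_⟩ (solve (a ∷ c ∷ e ∷ g ∷ [])) (solve (b ∷ d ∷ f ∷ h ∷ []))

    four-term-⊟ʳ : ∀ X₁ X₂ X₃ X₄ → (X₁ ⊟ X₂ ⊞ X₃ ⊟ X₄) ⊟ (X₁ ⊟ X₄) ≡ X₃ ⊟ X₂
    four-term-⊟ʳ ⟨ a , b ⟩ ⟨ c , d ⟩ ⟨ e , f ⟩ ⟨ g , h ⟩ = cong₂ ⟨_,_⟩ (solve (a ∷ c ∷ e ∷ g ∷ [])) (solve (b ∷ d ∷ f ∷ h ∷ []))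

    four-term-⊞-neg : ∀ X₁ X₂ X₃ X₄ → (X₁ ⊟ X₂ ⊞ X₃ ⊟ X₄) ⊞ (X₄ ⊟ neg X₂) ≡ X₃ ⊟ neg X₁
    four-term-⊞-neg ⟨ a , b ⟩ ⟨ c , d ⟩ ⟨ e , f ⟩ ⟨ g , h ⟩ = cong₂ ⟨_,_⟩ (solve (a ∷ c ∷ e ∷ g ∷ [])) (solve (b ∷ d ∷ f ∷ h ∷ []))

    norm-one⇒⊠-conj≡1ᴿ : ∀ Z → norm Z ≡ + 1 → Z ⊠ conj Z ≡ 1ᴿ
    norm-one⇒⊠-conj≡1ᴿ Z nZ = trans (⊠-conj Z) (cong ι nZ)

    ⊠-conj-cancel : ∀ Z X → norm Z ≡ + 1 → Z ⊠ (conj Z ⊠ X) ≡ X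
    ⊠-conj-cancel Z X nZ = begin
      Z ⊠ (conj Z ⊠ X)  ≡⟨ sym (⊠-assoc Z (conj Z) X) ⟩
      Z ⊠ conj Z ⊠ X    ≡⟨ cong (_⊠ X) (norm-one⇒⊠-conj≡1ᴿ Z nZ) ⟩
      1ᴿ ⊠ X            ≡⟨ 1ᴿ-⊠ X ⟩
      X                 ∎
      where open ≡-Reasoning

    conj-⊠-cancel : ∀ Z X → norm Z ≡ + 1 → conj Z ⊠ (Z ⊠ X) ≡ X
    conj-⊠-cancel Z X nZ = begin
      conj Z ⊠ (Z ⊠ X)  ≡⟨ sym (⊠-assoc (conj Z) Z X) ⟩
      conj Z ⊠ Z ⊠ X    ≡⟨ cong (_⊠ X) (⊠-comm (conj Z) Z) ⟩
      Z ⊠ conj Z ⊠ X    ≡⟨ ⊠-assoc Z (conj Z) X ⟩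
      Z ⊠ (conj Z ⊠ X)  ≡⟨ ⊠-conj-cancel Z X nZ ⟩
      X                 ∎
      where open ≡-Reasoning

    norm-one-⊞ : ∀ U V → norm U ≡ + 1 → norm V ≡ + 1 → U ⊠ V ⊠ conj (U ⊞ V) ≡ U ⊞ V
    norm-one-⊞ U V nU nV = begin
      U ⊠ V ⊠ conj (U ⊞ V)             ≡⟨ expand U V ⟩
      V ⊠ conj V ⊠ U ⊞ U ⊠ conj U ⊠ V   ≡⟨ cong₂ (λ X Y → X ⊠ U ⊞ Y ⊠ V) (norm-one⇒⊠-conj≡1ᴿ V nV) (norm-one⇒⊠-conj≡1ᴿ U nU) ⟩
      1ᴿ ⊠ U ⊞ 1ᴿ ⊠ V                  ≡⟨ cong₂ _⊞_ (1ᴿ-⊠ U) (1ᴿ-⊠ V) ⟩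
      U ⊞ V                            ∎
      where
      open ≡-Reasoning
      expand : ∀ U V → U ⊠ V ⊠ conj (U ⊞ V) ≡ V ⊠ conj V ⊠ U ⊞ U ⊠ conj U ⊠ V
      expand ⟨ a , b ⟩ ⟨ c , d ⟩ = cong₂ ⟨_,_⟩ (solve (a ∷ b ∷ c ∷ d ∷ τ ∷ [])) (solve (a ∷ b ∷ c ∷ d ∷ τ ∷ []))

    ξ-⊠ : ∀ x y → ξ ⊠ ⟨ x , y ⟩ ≡ ⟨ - y , x + τ * y ⟩
    ξ-⊠ x y = cong₂ ⟨_,_⟩ (solve (x ∷ y ∷ [])) (solve (x ∷ y ∷ τ ∷ []))

    norm-ξ : norm ξ ≡ + 1
    norm-ξ = unit τ
      where
      unit : ∀ τ → + 0 * + 0 + τ * + 0 * + 1 + + 1 * + 1 ≡ + 1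
      unit = solve-∀

    ξ^-+ : ∀ i j → ξ^ (i ℕ.+ j) ≡ ξ^ i ⊠ ξ^ j
    ξ^-+ zero j = sym (1ᴿ-⊠ (ξ^ j))
    ξ^-+ (suc i) j = trans (cong (ξ ⊠_) (ξ^-+ i j)) (sym (⊠-assoc ξ (ξ^ i) (ξ^ j)))

    norm-ξ^ : ∀ i → norm (ξ^ i) ≡ + 1
    norm-ξ^ zero = unit τ
      where
      unit : ∀ τ → + 1 * + 1 + τ * + 1 * + 0 + + 0 * + 0 ≡ + 1
      unit = solve-∀
    norm-ξ^ (suc i) = trans (norm-⊠ ξ (ξ^ i)) (cong₂ _*_ norm-ξ (norm-ξ^ i))

    infix 4 _∣ᴿ_ _≡ᴿ_[mod_] _≡ᴿ_[mod-all_]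

    record _∣ᴿ_ (m : ℕ) (X : R) : Set where
      constructor both
      field
        re-∣ : + m ∣ re X
        im-∣ : + m ∣ im X

    _≡ᴿ_[mod_] : R → R → ℕ → Set
    X ≡ᴿ Y [mod m ] = m ∣ᴿ X ⊟ Y

    _≡ᴿ_[mod-all_] : R → R → List ℕ → Set
    X ≡ᴿ Y [mod-all ps ] = All (X ≡ᴿ Y [mod_]) ps

    ∣ᴿ? : ∀ m X → Dec (m ∣ᴿ X)
    ∣ᴿ? m X = map′ (λ (m∣a , m∣b) → both m∣a m∣b) (λ (both m∣a m∣b) → m∣a , m∣b) ((+ m ∣? re X) ×-dec (+ m ∣? im X))

    module _ {m : ℕ} where

      ∣ᴿ-resp-≡ : ∀ {X Y} → X ≡ Y → m ∣ᴿ X → m ∣ᴿ Y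
      ∣ᴿ-resp-≡ refl m∣X = m∣X

      ∣ᴿ-0 : m ∣ᴿ ι (+ 0)
      ∣ᴿ-0 = both m∣0 m∣0
        where
        m∣0 : + m ∣ + 0
        m∣0 = divides (+ 0) (sym (ℤ.*-zeroˡ (+ m)))

      ∣ᴿ-⊞ : ∀ {X Y} → m ∣ᴿ X → m ∣ᴿ Y → m ∣ᴿ X ⊞ Y
      ∣ᴿ-⊞ {⟨ _ , _ ⟩} {⟨ _ , _ ⟩} (both m∣a m∣b) (both m∣c m∣d) = both (∣m∣n⇒∣m+n m∣a m∣c) (∣m∣n⇒∣m+n m∣b m∣d)

      ∣ᴿ-⊟ : ∀ {X Y} → m ∣ᴿ X → m ∣ᴿ Y → m ∣ᴿ X ⊟ Y
      ∣ᴿ-⊟ {⟨ _ , _ ⟩} {⟨ _ , _ ⟩} (both m∣a m∣b) (both m∣c m∣d) = both (∣m∣n⇒∣m-n m∣a m∣c) (∣m∣n⇒∣m-n m∣b m∣d)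

      ∣ᴿ-neg : ∀ {X} → m ∣ᴿ X → m ∣ᴿ neg X
      ∣ᴿ-neg {⟨ _ , _ ⟩} (both m∣a m∣b) = both (∣m⇒∣-m m∣a) (∣m⇒∣-m m∣b)

      ∣ᴿ-⊠ˡ : ∀ Z {X} → m ∣ᴿ X → m ∣ᴿ Z ⊠ X
      ∣ᴿ-⊠ˡ ⟨ a , b ⟩ {⟨ _ , _ ⟩} (both m∣c m∣d) = both
        (∣m∣n⇒∣m-n (∣n⇒∣m*n a m∣c) (∣n⇒∣m*n b m∣d))
        (∣m∣n⇒∣m+n (∣m∣n⇒∣m+n (∣n⇒∣m*n a m∣d) (∣n⇒∣m*n b m∣c)) (∣n⇒∣m*n (τ * b) m∣d))

      ∣ᴿ-conj : ∀ {X} → m ∣ᴿ X → m ∣ᴿ conj X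
      ∣ᴿ-conj {⟨ _ , _ ⟩} (both m∣a m∣b) = both (∣m∣n⇒∣m+n m∣a (∣n⇒∣m*n τ m∣b)) (∣m⇒∣-m m∣b)

      ∣ᴿ⇒∣norm : ∀ {X} → m ∣ᴿ X → + m ∣ norm X
      ∣ᴿ⇒∣norm {⟨ a , b ⟩} (both m∣a m∣b) =
        ∣m∣n⇒∣m+n (∣m∣n⇒∣m+n (∣n⇒∣m*n a m∣a) (∣n⇒∣m*n (τ * a) m∣b)) (∣m⇒∣m*n b m∣b)

      ≡ᴿ-refl : ∀ {X} → X ≡ᴿ X [mod m ]
      ≡ᴿ-refl {X} = ∣ᴿ-resp-≡ (sym (⊟-self X)) ∣ᴿ-0

      ≡ᴿ-sym : ∀ {X Y} → X ≡ᴿ Y [mod m ] → Y ≡ᴿ X [mod m ]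
      ≡ᴿ-sym {X} {Y} X≡Y = ∣ᴿ-resp-≡ (neg-⊟ X Y) (∣ᴿ-neg X≡Y)

      ≡ᴿ-trans : ∀ {X Y Z} → X ≡ᴿ Y [mod m ] → Y ≡ᴿ Z [mod m ] → X ≡ᴿ Z [mod m ]
      ≡ᴿ-trans {X} {Y} {Z} X≡Y Y≡Z = ∣ᴿ-resp-≡ (⊟-⊞-⊟ X Y Z) (∣ᴿ-⊞ X≡Y Y≡Z)

      ≡ᴿ-⊠ˡ : ∀ Z {X Y} → X ≡ᴿ Y [mod m ] → Z ⊠ X ≡ᴿ Z ⊠ Y [mod m ]
      ≡ᴿ-⊠ˡ Z {X} {Y} X≡Y = ∣ᴿ-resp-≡ (⊠-⊟-distribˡ Z X Y) (∣ᴿ-⊠ˡ Z X≡Y)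

      ≡ᴿ-⊠ʳ : ∀ Z {X Y} → X ≡ᴿ Y [mod m ] → X ⊠ Z ≡ᴿ Y ⊠ Z [mod m ]
      ≡ᴿ-⊠ʳ Z {X} {Y} X≡Y = subst₂ (_≡ᴿ_[mod m ]) (⊠-comm Z X) (⊠-comm Z Y) (≡ᴿ-⊠ˡ Z X≡Y)

      ≡ᴿ-cancel : ∀ Z {X Y} → norm Z ≡ + 1 → Z ⊠ X ≡ᴿ Z ⊠ Y [mod m ] → X ≡ᴿ Y [mod m ]
      ≡ᴿ-cancel Z {X} {Y} nZ ZX≡ZY =
        subst₂ (_≡ᴿ_[mod m ]) (conj-⊠-cancel Z X nZ) (conj-⊠-cancel Z Y nZ) (≡ᴿ-⊠ˡ (conj Z) ZX≡ZY)

    ≡ᴿ-∣ : ∀ {m n X Y} → n ℕ∣.∣ m → X ≡ᴿ Y [mod m ] → X ≡ᴿ Y [mod n ]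
    ≡ᴿ-∣ n∣m (both m∣a m∣b) = both (∣-trans (∣ᵤ⇒∣ n∣m) m∣a) (∣-trans (∣ᵤ⇒∣ n∣m) m∣b)

    ≡ᴿ-product : ∀ {ps X Y} → Unique ps → All Prime ps → X ≡ᴿ Y [mod-all ps ] → X ≡ᴿ Y [mod product ps ]
    ≡ᴿ-product {ps} {X} {Y} unique primes X≡Y =
      both (product-∣ᶻ (re (X ⊟ Y)) (All.map _∣ᴿ_.re-∣ X≡Y)) (product-∣ᶻ (im (X ⊟ Y)) (All.map _∣ᴿ_.im-∣ X≡Y))
      where
      product-∣ᶻ : ∀ x → All (λ p → + p ∣ x) ps → + product ps ∣ x
      product-∣ᶻ x p∣x = ∣ᵤ⇒∣ {i = x} (product-∣ unique primes (All.map ∣⇒∣ᵤ p∣x))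

    same-residues⇒≡ᴿ : ∀ {g} .{{_ : NonZero g}} X Y → re X %ℕ g ≡ re Y %ℕ g → im X %ℕ g ≡ im Y %ℕ g →
      X ≡ᴿ Y [mod g ]
    same-residues⇒≡ᴿ ⟨ a , b ⟩ ⟨ c , d ⟩ a≡c b≡d = both (≡-%ℕ⇒∣- a c a≡c) (≡-%ℕ⇒∣- b d b≡d)

    ξ^-period : ∀ {m r} k → ξ^ r ≡ᴿ 1ᴿ [mod m ] → ξ^ (r ℕ.+ k) ≡ᴿ ξ^ k [mod m ]
    ξ^-period {m} {r} k ξ^r≡1 =
      subst₂ (_≡ᴿ_[mod m ]) (sym (ξ^-+ r k)) (1ᴿ-⊠ (ξ^ k)) (≡ᴿ-⊠ʳ (ξ^ k) ξ^r≡1)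

    ξ^-cancel : ∀ {m} y k → ξ^ (y ℕ.+ k) ≡ᴿ ξ^ y [mod m ] → ξ^ k ≡ᴿ 1ᴿ [mod m ]
    ξ^-cancel {m} y k ξ^[y+k]≡ξ^y =
      ≡ᴿ-cancel (ξ^ y) (norm-ξ^ y) (subst₂ (_≡ᴿ_[mod m ]) (ξ^-+ y k) (sym (⊠-1ᴿ (ξ^ y))) ξ^[y+k]≡ξ^y)

    ξ^-multiple : ∀ {m r} q → ξ^ r ≡ᴿ 1ᴿ [mod m ] → ξ^ (q ℕ.* r) ≡ᴿ 1ᴿ [mod m ]
    ξ^-multiple zero ξ^r≡1 = ≡ᴿ-refl {X = 1ᴿ}
    ξ^-multiple {r = r} (suc q) ξ^r≡1 = ≡ᴿ-trans (ξ^-period {r = r} (q ℕ.* r) ξ^r≡1) (ξ^-multiple q ξ^r≡1)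

    -- pigeonhole on the g² residue classes of ξ⁰, …, ξ^(g²)
    ξ^-returns : ∀ g → 1 ≤ g → ∃ λ e → 1 ≤ e × e ≤ g ℕ.* g × ξ^ e ≡ᴿ 1ᴿ [mod g ]
    ξ^-returns g@(suc _) _ with pigeonhole (n<1+n (g ℕ.* g)) cell
      where
      residue : ℤ → Fin g
      residue z = fromℕ< (n%ℕd<d z g)
      cell : Fin (suc (g ℕ.* g)) → Fin (g ℕ.* g)
      cell k = combine (residue (re (ξ^ toℕ k))) (residue (im (ξ^ toℕ k)))
    ... | iᶠ , jᶠ , i<j , same-cell =
      j ∸ i , m<n⇒0<n∸m i<j , ≤-trans (m∸n≤m j i) (≤-pred (toℕ<n jᶠ)) ,
      ξ^-cancel i (j ∸ i) (subst (λ k → ξ^ k ≡ᴿ ξ^ i [mod g ]) (sym (m+[n∸m]≡n (<⇒≤ i<j)))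
        (same-residues⇒≡ᴿ (ξ^ j) (ξ^ i) (same-residue (re (ξ^ i)) (re (ξ^ j)) (proj₁ same-residues))
                                        (same-residue (im (ξ^ i)) (im (ξ^ j)) (proj₂ same-residues))))
      where
      i = toℕ iᶠ
      j = toℕ jᶠ
      same-residues = combine-injective _ _ _ _ same-cell
      same-residue : ∀ a b → fromℕ< (n%ℕd<d a g) ≡ fromℕ< (n%ℕd<d b g) → b %ℕ g ≡ a %ℕ g
      same-residue a b = sym ∘ fromℕ<-injective (a %ℕ g) (b %ℕ g) _ _

    ξ-Period : List ℕ → ℕ → Set
    ξ-Period ps k = ξ^ k ≡ᴿ 1ᴿ [mod-all ps ]

    ξ-period? : ∀ ps k → Dec (ξ-Period ps k)
    ξ-period? ps k = All.all? (λ m → ∣ᴿ? m (ξ^ k ⊟ 1ᴿ)) ps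

    module _ {ps : List ℕ} {r : ℕ} (order : LeastPositive (ξ-Period ps) r) where

      order-∣ : ∀ {s} → ξ-Period ps s → r ℕ∣.∣ s
      order-∣ = leastPositive-∣ order (λ k → All.zipWith (λ (ξ^r≡1 , ξ^[r+k]≡1) →
                  ≡ᴿ-trans (≡ᴿ-sym (ξ^-period {r = r} k ξ^r≡1)) ξ^[r+k]≡1) ∘ (proj₁ (proj₂ order) ,_)) _

      order-∣-∸ : ∀ {x y} → y ≤ x → ξ^ x ≡ᴿ ξ^ y [mod-all ps ] → r ℕ∣.∣ x ∸ y
      order-∣-∸ {x} {y} y≤x ξ^x≡ξ^y =
        order-∣ (All.map (ξ^-cancel y (x ∸ y) ∘ subst (λ z → ξ^ z ≡ᴿ ξ^ y [mod _ ]) (sym (m+[n∸m]≡n y≤x))) ξ^x≡ξ^y)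

    module _ {p : ℕ} (p-prime : Prime p) (p∤disc : ¬ + p ∣ disc) where

      private
        euclid = euclidsLemmaℤ p-prime
        euclid-square = euclidsLemmaℤ-square p-prime

      -- disc · im² = trace² - 4 norm with p ∤ disc gives p ∣ im, and then p ∣ re² = norm - im (τ re + im)
      ∣trace-norm⇒∣ᴿ : ∀ X → + p ∣ trace X → + p ∣ norm X → p ∣ᴿ X
      ∣trace-norm⇒∣ᴿ X p∣trace p∣norm = both p∣re p∣im
        where
        p∣im : + p ∣ im X
        p∣im = [ (λ p∣disc → ⊥-elim (p∤disc p∣disc)) , euclid-square (im X) ]′
                 (euclid disc (im X * im X) (subst (+ p ∣_) (sym (disc-trace-norm X))
                    (∣m∣n⇒∣m-n (∣n⇒∣m*n (trace X) p∣trace) (∣n⇒∣m*n (+ 4) p∣norm))))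
        p∣re : + p ∣ re X
        p∣re = euclid-square (re X) (subst (+ p ∣_) (sym (re²-norm X)) (∣m∣n⇒∣m-n p∣norm (∣m⇒∣m*n (τ * re X + im X) p∣im)))

      -- Y = conj V (U - V) has norm N(U - V) and, as N U = N V, trace -N(U - V)
      norm-one-∣norm⇒≡ᴿ : ∀ U V → norm U ≡ + 1 → norm V ≡ + 1 → + p ∣ norm (U ⊟ V) → U ≡ᴿ V [mod p ]
      norm-one-∣norm⇒≡ᴿ U V nU nV p∣N = ∣ᴿ-resp-≡ (⊠-conj-cancel V (U ⊟ V) nV) (∣ᴿ-⊠ˡ V p∣Y)
        where
        Y = conj V ⊠ (U ⊟ V)
        norm-Y : norm Y ≡ norm (U ⊟ V)
        norm-Y = trans (norm-⊠ (conj V) (U ⊟ V))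
                       (trans (cong (_* norm (U ⊟ V)) (trans (norm-conj V) nV)) (ℤ.*-identityˡ _))
        one-minus-one : ∀ x → + 1 - + 1 - x ≡ - x
        one-minus-one x = solve (x ∷ [])
        trace-Y : trace Y ≡ - norm (U ⊟ V)
        trace-Y = trans (trace-conj-⊠-⊟ U V)
                        (trans (cong₂ (λ x y → x - y - norm (U ⊟ V)) nU nV) (one-minus-one (norm (U ⊟ V))))
        p∣Y : p ∣ᴿ Y
        p∣Y = ∣trace-norm⇒∣ᴿ Y (subst (+ p ∣_) (sym trace-Y) (∣m⇒∣-m p∣N)) (subst (+ p ∣_) (sym norm-Y) p∣N)

      module _ (X₁ X₂ X₃ X₄ : R) (n₁ : norm X₁ ≡ + 1) (n₂ : norm X₂ ≡ + 1) (n₃ : norm X₃ ≡ + 1) (n₄ : norm X₄ ≡ + 1)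
               (p∣E : p ∣ᴿ X₁ ⊟ X₂ ⊞ X₃ ⊟ X₄) where

        -- X₁ + X₃ ≡ X₂ + X₄, and U V conj (U + V) = U + V for units U, V
        cross-term≡0 : p ∣ᴿ (X₂ ⊠ X₄ ⊟ X₁ ⊠ X₃) ⊠ conj (X₂ ⊞ X₄)
        cross-term≡0 = ∣ᴿ-resp-≡ (sym (cross-term-expand X₁ X₂ X₃ X₄))
          (∣ᴿ-⊞ (∣ᴿ-⊟ (vanish X₂ X₄ n₂ n₄) (vanish X₁ X₃ n₁ n₃)) (∣ᴿ-⊟ (∣ᴿ-⊠ˡ (X₁ ⊠ X₃) (∣ᴿ-conj p∣E)) p∣E))
          where
          vanish : ∀ U V → norm U ≡ + 1 → norm V ≡ + 1 → p ∣ᴿ U ⊠ V ⊠ conj (U ⊞ V) ⊟ (U ⊞ V)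
          vanish U V nU nV = subst (λ Z → p ∣ᴿ Z ⊟ (U ⊞ V)) (sym (norm-one-⊞ U V nU nV)) ≡ᴿ-refl

        pairs : + p ∣ norm (X₂ ⊠ X₄ ⊟ X₁ ⊠ X₃) →
          (X₁ ≡ᴿ X₂ [mod p ] × X₃ ≡ᴿ X₄ [mod p ]) ⊎ (X₁ ≡ᴿ X₄ [mod p ] × X₃ ≡ᴿ X₂ [mod p ])
        pairs p∣N[W] = Sum.map first second (euclid (norm (X₁ ⊟ X₂)) (norm (X₁ ⊟ X₄)) p∣N[X₁-X₂]N[X₁-X₄])
          where
          p∣W : p ∣ᴿ X₂ ⊠ X₄ ⊟ X₁ ⊠ X₃
          p∣W = norm-one-∣norm⇒≡ᴿ (X₂ ⊠ X₄) (X₁ ⊠ X₃) (trans (norm-⊠ X₂ X₄) (cong₂ _*_ n₂ n₄))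
                                                     (trans (norm-⊠ X₁ X₃) (cong₂ _*_ n₁ n₃)) p∣N[W]
          p∣N[X₁-X₂]N[X₁-X₄] : + p ∣ norm (X₁ ⊟ X₂) * norm (X₁ ⊟ X₄)
          p∣N[X₁-X₂]N[X₁-X₄] = subst (+ p ∣_) (norm-⊠ (X₁ ⊟ X₂) (X₁ ⊟ X₄))
            (∣ᴿ⇒∣norm (∣ᴿ-resp-≡ (four-term-factor X₁ X₂ X₃ X₄) (∣ᴿ-⊞ (∣ᴿ-⊠ˡ X₁ p∣E) p∣W)))
          first : + p ∣ norm (X₁ ⊟ X₂) → X₁ ≡ᴿ X₂ [mod p ] × X₃ ≡ᴿ X₄ [mod p ]
          first p∣N = X₁≡X₂ , ∣ᴿ-resp-≡ (four-term-⊟ˡ X₁ X₂ X₃ X₄) (∣ᴿ-⊟ p∣E X₁≡X₂)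
            where X₁≡X₂ = norm-one-∣norm⇒≡ᴿ X₁ X₂ n₁ n₂ p∣N
          second : + p ∣ norm (X₁ ⊟ X₄) → X₁ ≡ᴿ X₄ [mod p ] × X₃ ≡ᴿ X₂ [mod p ]
          second p∣N = X₁≡X₄ , ∣ᴿ-resp-≡ (four-term-⊟ʳ X₁ X₂ X₃ X₄) (∣ᴿ-⊟ p∣E X₁≡X₄)
            where X₁≡X₄ = norm-one-∣norm⇒≡ᴿ X₁ X₄ n₁ n₄ p∣N

        opposites : + p ∣ norm (conj (X₂ ⊞ X₄)) → X₃ ≡ᴿ neg X₁ [mod p ] × X₄ ≡ᴿ neg X₂ [mod p ]
        opposites p∣N[T] = ∣ᴿ-resp-≡ (four-term-⊞-neg X₁ X₂ X₃ X₄) (∣ᴿ-⊞ p∣E X₄≡-X₂) , X₄≡-X₂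
          where
          X₄≡-X₂ : X₄ ≡ᴿ neg X₂ [mod p ]
          X₄≡-X₂ = norm-one-∣norm⇒≡ᴿ X₄ (neg X₂) n₄ (trans (norm-neg X₂) n₂)
                     (subst (+ p ∣_) (trans (norm-conj (X₂ ⊞ X₄)) (cong norm (⊞-as-⊟-neg X₂ X₄))) p∣N[T])
        four-units : (X₁ ≡ᴿ X₂ [mod p ] × X₃ ≡ᴿ X₄ [mod p ]) ⊎ (X₁ ≡ᴿ X₄ [mod p ] × X₃ ≡ᴿ X₂ [mod p ])
                       ⊎ (X₃ ≡ᴿ neg X₁ [mod p ] × X₄ ≡ᴿ neg X₂ [mod p ])
        four-units = Sum.assocʳ (Sum.map pairs opposites (euclid (norm (X₂ ⊠ X₄ ⊟ X₁ ⊠ X₃)) (norm (conj (X₂ ⊞ X₄)))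
                       (subst (+ p ∣_) (norm-⊠ (X₂ ⊠ X₄ ⊟ X₁ ⊠ X₃) (conj (X₂ ⊞ X₄))) (∣ᴿ⇒∣norm cross-term≡0))))

module Matrices where

  open import Data.Nat as ℕ using (ℕ; zero; suc; _≤_; _<_)
  import Data.Nat.Properties as ℕ
  open import Data.Nat.Primality using (Prime)
  open import Data.Integer as ℤ using (ℤ; +_; _+_; _*_; _-_; -_)
  import Data.Integer.Properties as ℤ
  open import Data.Integer.Divisibility.Signed using (_∣_; ∣ᵤ⇒∣; ∣⇒∣ᵤ; ∣m∣n⇒∣m+n; ∣m∣n⇒∣m-n; ∣n⇒∣m*n; ∣m⇒∣m*n)
  open import Data.List using (_∷_; [])
  open import Data.Product using (_×_; _,_; proj₁; proj₂)
  open import Data.Sum using (inj₁; inj₂; [_,_]′)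
  open import Data.Empty using (⊥-elim)
  open import Relation.Binary.PropositionalEquality
  open import Relation.Nullary using (¬_; Dec; yes; no)
  import Data.Nat.Divisibility as ℕ∣
  open import Data.Integer.Tactic.RingSolver using (solve; solve-∀)
  open Quadratic
  open Arithmetic using (euclidsLemmaℤ; euclidsLemmaℤ-square; nonsquare-irrational)
  open Discriminant using (disc-between-squares; square-abs)
  open import Function using (id; _∘_)
  open import Defs

  mat-≡ : ∀ {a b c d a′ b′ c′ d′ : ℤ} → a ≡ a′ → b ≡ b′ → c ≡ c′ → d ≡ d′ → mat a b c d ≡ mat a′ b′ c′ d′
  mat-≡ refl refl refl refl = refl

  ∣-resp-≡ : ∀ {k x y} → k ∣ x → x ≡ y → k ∣ y
  ∣-resp-≡ k∣x refl = k∣x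

  ≡0mod⇒∣ : ∀ {m} x → x ≡0mod m → + m ∣ x
  ≡0mod⇒∣ x = ∣ᵤ⇒∣ {i = x}

  normSq≡ : ∀ x y → normSq (x , y) ≡ ℤ.∣ x ∣ ℕ.* ℤ.∣ x ∣ ℕ.+ ℤ.∣ y ∣ ℕ.* ℤ.∣ y ∣
  normSq≡ x y = cong ℤ.∣_∣ (trans (cong₂ _+_ (square-abs x) (square-abs y)) (sym (ℤ.pos-+ (ℤ.∣ x ∣ ℕ.* ℤ.∣ x ∣) (ℤ.∣ y ∣ ℕ.* ℤ.∣ y ∣))))

  1≤∣z∣² : ∀ {z} → z ≢ + 0 → 1 ≤ ℤ.∣ z ∣ ℕ.* ℤ.∣ z ∣
  1≤∣z∣² z≢0 = ℕ.*-mono-≤ 1≤∣z∣ 1≤∣z∣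
    where 1≤∣z∣ = ℕ.n≢0⇒n>0 (z≢0 ∘ ℤ.∣i∣≡0⇒i≡0)

  1≤normSq : ∀ n → NonZeroVec n → 1 ≤ normSq n
  1≤normSq (x , y) n≢0 = subst (1 ≤_) (sym (normSq≡ x y)) (positive (x ℤ.≟ + 0) (y ℤ.≟ + 0))
    where
    positive : Dec (x ≡ + 0) → Dec (y ≡ + 0) → 1 ≤ ℤ.∣ x ∣ ℕ.* ℤ.∣ x ∣ ℕ.+ ℤ.∣ y ∣ ℕ.* ℤ.∣ y ∣
    positive (yes x≡0) (yes y≡0) = ⊥-elim (n≢0 (x≡0 , y≡0))
    positive (no x≢0)  _         = ℕ.≤-trans (1≤∣z∣² x≢0) (ℕ.m≤m+n _ _)
    positive (yes _)   (no y≢0)  = ℕ.≤-trans (1≤∣z∣² y≢0) (ℕ.m≤n+m _ _)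

  ≡ᴹ-∣ : ∀ {d N} M P → d ℕ∣.∣ N → M ≡ᴹ P [mod N ] → M ≡ᴹ P [mod d ]
  ≡ᴹ-∣ M P d∣N (a∣ , b∣ , c∣ , d∣) = ℕ∣.∣-trans d∣N a∣ , ℕ∣.∣-trans d∣N b∣ , ℕ∣.∣-trans d∣N c∣ , ℕ∣.∣-trans d∣N d∣

  Vec≡0mod-∣ : ∀ {d N} v → d ℕ∣.∣ N → Vec≡0mod v N → Vec≡0mod v d
  Vec≡0mod-∣ (x , y) d∣N (x∣ , y∣) = ℕ∣.∣-trans d∣N x∣ , ℕ∣.∣-trans d∣N y∣

  module PowersOfA (α β γ δ : ℤ) (det≡1 : det (mat α β γ δ) ≡ + 1) where

    A : Mat2
    A = mat α β γ δ

    open QuadraticRing (tr A)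

    -- ⟨ x , y ⟩ acts as x I + y A; Cayley–Hamilton A² = τ A - I makes this a ring map
    toMatrix : R → Mat2
    toMatrix ⟨ x , y ⟩ = mat (x + y * α) (y * β) (y * γ) (x + y * δ)

    private
      modulo-det : ∀ {u v} w → u ≡ v + w * (+ 1 - det A) → u ≡ v
      modulo-det {u} {v} w u≡v+w[1-det] = trans u≡v+w[1-det] (trans (cong (λ z → v + w * (+ 1 - z)) det≡1) (solve (v ∷ w ∷ [])))

    A⊗toMatrix : ∀ X → A ⊗ toMatrix X ≡ toMatrix (ξ ⊠ X)
    A⊗toMatrix ⟨ x , y ⟩ = trans
      (mat-≡ (modulo-det y (entry-a α β γ δ x y)) (entry-b α β γ δ x y)
             (entry-c α β γ δ x y) (modulo-det y (entry-d α β γ δ x y)))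
      (cong toMatrix (sym (ξ-⊠ x y)))
      where
      entry-a : ∀ α β γ δ x y →
        α * (x + y * α) + β * (y * γ) ≡ - y + (x + (α + δ) * y) * α + y * (+ 1 - (α * δ - β * γ))
      entry-a = solve-∀
      entry-b : ∀ α β γ δ x y → α * (y * β) + β * (x + y * δ) ≡ (x + (α + δ) * y) * β
      entry-b = solve-∀
      entry-c : ∀ α β γ δ x y → γ * (x + y * α) + δ * (y * γ) ≡ (x + (α + δ) * y) * γ
      entry-c = solve-∀
      entry-d : ∀ α β γ δ x y →
        γ * (y * β) + δ * (x + y * δ) ≡ - y + (x + (α + δ) * y) * δ + y * (+ 1 - (α * δ - β * γ))
      entry-d = solve-∀

    A^≡toMatrix : ∀ i → A ^ᴹ i ≡ toMatrix (ξ^ i)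
    A^≡toMatrix zero = refl
    A^≡toMatrix (suc i) = trans (cong (A ⊗_) (A^≡toMatrix i)) (A⊗toMatrix (ξ^ i))

    toMatrix-⊞ : ∀ X Y → toMatrix X ⊕ toMatrix Y ≡ toMatrix (X ⊞ Y)
    toMatrix-⊞ ⟨ x , y ⟩ ⟨ x′ , y′ ⟩ = mat-≡ (diagonal α) (off-diagonal β) (off-diagonal γ) (diagonal δ)
      where
      diagonal : ∀ α → (x + y * α) + (x′ + y′ * α) ≡ (x + x′) + (y + y′) * α
      diagonal α = solve (x ∷ y ∷ x′ ∷ y′ ∷ α ∷ [])
      off-diagonal : ∀ β → y * β + y′ * β ≡ (y + y′) * β
      off-diagonal β = solve (y ∷ y′ ∷ β ∷ [])

    toMatrix-⊟ : ∀ X Y → toMatrix X ⊖ toMatrix Y ≡ toMatrix (X ⊟ Y)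
    toMatrix-⊟ ⟨ x , y ⟩ ⟨ x′ , y′ ⟩ = mat-≡ (diagonal α) (off-diagonal β) (off-diagonal γ) (diagonal δ)
      where
      diagonal : ∀ α → (x + y * α) - (x′ + y′ * α) ≡ (x - x′) + (y - y′) * α
      diagonal α = solve (x ∷ y ∷ x′ ∷ y′ ∷ α ∷ [])
      off-diagonal : ∀ β → y * β - y′ * β ≡ (y - y′) * β
      off-diagonal β = solve (y ∷ y′ ∷ β ∷ [])

    A^-alternating-sum : ∀ i j k l →
      (((A ^ᴹ i) ⊖ (A ^ᴹ j)) ⊕ (A ^ᴹ k)) ⊖ (A ^ᴹ l) ≡ toMatrix (ξ^ i ⊟ ξ^ j ⊞ ξ^ k ⊟ ξ^ l)
    A^-alternating-sum i j k l = begin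
      (((A ^ᴹ i) ⊖ (A ^ᴹ j)) ⊕ (A ^ᴹ k)) ⊖ (A ^ᴹ l)
        ≡⟨ cong₂ _⊖_ (cong₂ _⊕_ (cong₂ _⊖_ (A^≡toMatrix i) (A^≡toMatrix j)) (A^≡toMatrix k)) (A^≡toMatrix l) ⟩
      ((toMatrix (ξ^ i) ⊖ toMatrix (ξ^ j)) ⊕ toMatrix (ξ^ k)) ⊖ toMatrix (ξ^ l)
        ≡⟨ cong (λ M → (M ⊕ toMatrix (ξ^ k)) ⊖ toMatrix (ξ^ l)) (toMatrix-⊟ (ξ^ i) (ξ^ j)) ⟩
      (toMatrix (ξ^ i ⊟ ξ^ j) ⊕ toMatrix (ξ^ k)) ⊖ toMatrix (ξ^ l)
        ≡⟨ cong (_⊖ toMatrix (ξ^ l)) (toMatrix-⊞ (ξ^ i ⊟ ξ^ j) (ξ^ k)) ⟩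
      toMatrix (ξ^ i ⊟ ξ^ j ⊞ ξ^ k) ⊖ toMatrix (ξ^ l)
        ≡⟨ toMatrix-⊟ (ξ^ i ⊟ ξ^ j ⊞ ξ^ k) (ξ^ l) ⟩
      toMatrix (ξ^ i ⊟ ξ^ j ⊞ ξ^ k ⊟ ξ^ l) ∎
      where open ≡-Reasoning

    toMatrix-1ᴿ : toMatrix 1ᴿ ≡ I₂
    toMatrix-1ᴿ = sym (A^≡toMatrix 0)

    infix 4 _∣ᴹ_
    _∣ᴹ_ : ℕ → Mat2 → Set
    m ∣ᴹ M = (a M ≡0mod m) × (b M ≡0mod m) × (c M ≡0mod m) × (d M ≡0mod m)

    ∣ᴿ⇒∣ᴹ : ∀ {m} Y → m ∣ᴿ Y → m ∣ᴹ toMatrix Y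
    ∣ᴿ⇒∣ᴹ ⟨ x , y ⟩ (both m∣x m∣y) =
      ∣⇒∣ᵤ (∣m∣n⇒∣m+n m∣x (∣m⇒∣m*n α m∣y)) , ∣⇒∣ᵤ (∣m⇒∣m*n β m∣y) ,
      ∣⇒∣ᵤ (∣m⇒∣m*n γ m∣y) , ∣⇒∣ᵤ (∣m∣n⇒∣m+n m∣x (∣m⇒∣m*n δ m∣y))

    -- disc · y² = (a - d)² + 4 b c for the entries a, b, c, d of x I + y A
    ∣ᴹ⇒∣ᴿ : ∀ {p} → Prime p → ¬ + p ∣ disc → ∀ Y → p ∣ᴹ toMatrix Y → p ∣ᴿ Y
    ∣ᴹ⇒∣ᴿ {p} p-prime p∤disc ⟨ x , y ⟩ (p∣a , p∣b , p∣c , p∣d) = both p∣x p∣y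
      where
      entries : disc * (y * y) ≡ ((x + y * α) - (x + y * δ)) * ((x + y * α) - (x + y * δ)) + + 4 * (y * β) * (y * γ)
      entries = modulo-det (- (+ 4 * (y * y))) (identity α β γ δ x y)
        where
        identity : ∀ α β γ δ x y → ((α + δ) * (α + δ) - + 4) * (y * y)
          ≡ ((x + y * α) - (x + y * δ)) * ((x + y * α) - (x + y * δ)) + + 4 * (y * β) * (y * γ)
            + - (+ 4 * (y * y)) * (+ 1 - (α * δ - β * γ))
        identity = solve-∀
      p∣y : + p ∣ y
      p∣y = [ (λ p∣disc → ⊥-elim (p∤disc p∣disc)) , euclidsLemmaℤ-square p-prime y ]′
              (euclidsLemmaℤ p-prime disc (y * y) (∣-resp-≡
                (∣m∣n⇒∣m+n (∣n⇒∣m*n ((x + y * α) - (x + y * δ)) (∣m∣n⇒∣m-n (≡0mod⇒∣ (x + y * α) p∣a) (≡0mod⇒∣ (x + y * δ) p∣d)))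
                           (∣n⇒∣m*n (+ 4 * (y * β)) (≡0mod⇒∣ (y * γ) p∣c)))
                (sym entries)))
      p∣x : + p ∣ x
      p∣x = ∣-resp-≡ (∣m∣n⇒∣m-n (≡0mod⇒∣ (x + y * α) p∣a) (∣m⇒∣m*n α p∣y)) (solve (x ∷ y ∷ α ∷ []))

    toMatrix⊖I₂ : ∀ X → toMatrix X ⊖ I₂ ≡ toMatrix (X ⊟ 1ᴿ)
    toMatrix⊖I₂ X = trans (cong (toMatrix X ⊖_) (sym toMatrix-1ᴿ)) (toMatrix-⊟ X 1ᴿ)

    ≡ᴿ1⇒≡ᴹI : ∀ {m} X → X ≡ᴿ 1ᴿ [mod m ] → toMatrix X ≡ᴹ I₂ [mod m ]
    ≡ᴿ1⇒≡ᴹI {m} X X≡1 = subst (m ∣ᴹ_) (sym (toMatrix⊖I₂ X)) (∣ᴿ⇒∣ᴹ (X ⊟ 1ᴿ) X≡1)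

    ≡ᴹI⇒≡ᴿ1 : ∀ {p} → Prime p → ¬ + p ∣ disc → ∀ X → toMatrix X ≡ᴹ I₂ [mod p ] → X ≡ᴿ 1ᴿ [mod p ]
    ≡ᴹI⇒≡ᴿ1 {p} p-prime p∤disc X toMatrix≡I = ∣ᴹ⇒∣ᴿ p-prime p∤disc (X ⊟ 1ᴿ) (subst (p ∣ᴹ_) (toMatrix⊖I₂ X) toMatrix≡I)

    -- Q n is the determinant of the rows n and n A, a binary quadratic form of discriminant disc
    Q : Vec2 → ℤ
    Q (u , v) = u * (u * β + v * δ) - v * (u * α + v * γ)

    ·toMatrix≡0⇒∣ᴿ : ∀ {p} → Prime p → ∀ n → ¬ + p ∣ Q n → ∀ X → Vec≡0mod (n ·ᴹ toMatrix X) p → p ∣ᴿ X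
    ·toMatrix≡0⇒∣ᴿ {p} p-prime n@(u , v) p∤Q ⟨ x , y ⟩ (p∣w₁ , p∣w₂) = both (coefficient x Q*x p∣Q*x) (coefficient y Q*y p∣Q*y)
      where
      w₁ = u * (x + y * α) + v * (y * γ)
      w₂ = u * (y * β) + v * (x + y * δ)
      Q*x : Q n * x ≡ (u * β + v * δ) * w₁ - (u * α + v * γ) * w₂
      Q*x = identity α β γ δ u v x y
        where
        identity : ∀ α β γ δ u v x y → (u * (u * β + v * δ) - v * (u * α + v * γ)) * x
          ≡ (u * β + v * δ) * (u * (x + y * α) + v * (y * γ)) - (u * α + v * γ) * (u * (y * β) + v * (x + y * δ))
        identity = solve-∀
      Q*y : Q n * y ≡ u * w₂ - v * w₁
      Q*y = identity α β γ δ u v x y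
        where
        identity : ∀ α β γ δ u v x y → (u * (u * β + v * δ) - v * (u * α + v * γ)) * y
          ≡ u * (u * (y * β) + v * (x + y * δ)) - v * (u * (x + y * α) + v * (y * γ))
        identity = solve-∀
      p∣Q*x : + p ∣ (u * β + v * δ) * w₁ - (u * α + v * γ) * w₂
      p∣Q*x = ∣m∣n⇒∣m-n (∣n⇒∣m*n (u * β + v * δ) (≡0mod⇒∣ w₁ p∣w₁)) (∣n⇒∣m*n (u * α + v * γ) (≡0mod⇒∣ w₂ p∣w₂))
      p∣Q*y : + p ∣ u * w₂ - v * w₁
      p∣Q*y = ∣m∣n⇒∣m-n (∣n⇒∣m*n u (≡0mod⇒∣ w₂ p∣w₂)) (∣n⇒∣m*n v (≡0mod⇒∣ w₁ p∣w₁))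
      coefficient : ∀ z {w} → Q n * z ≡ w → + p ∣ w → + p ∣ z
      coefficient z Q*z≡w p∣w = [ ⊥-elim ∘ p∤Q , id ]′ (euclidsLemmaℤ p-prime (Q n) z (∣-resp-≡ p∣w (sym Q*z≡w)))

    β≢0 : 2 < ℤ.∣ tr A ∣ → β ≢ + 0
    β≢0 2<∣τ∣ β≡0 = ℕ.<⇒≱ 2<∣τ∣ (begin
      ℤ.∣ α + δ ∣           ≤⟨ ℤ.∣i+j∣≤∣i∣+∣j∣ α δ ⟩
      ℤ.∣ α ∣ ℕ.+ ℤ.∣ δ ∣   ≡⟨ cong₂ ℕ._+_ (ℕ.m*n≡1⇒m≡1 ℤ.∣ α ∣ ℤ.∣ δ ∣ ∣α∣∣δ∣≡1) (ℕ.m*n≡1⇒n≡1 ℤ.∣ α ∣ ℤ.∣ δ ∣ ∣α∣∣δ∣≡1) ⟩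
      2                     ∎)
      where
      open ℕ.≤-Reasoning
      αδ≡1 : α * δ ≡ + 1
      αδ≡1 = trans (sym (trans (cong (λ b → α * δ - b * γ) β≡0) (solve (α ∷ γ ∷ δ ∷ [])))) det≡1
      ∣α∣∣δ∣≡1 : ℤ.∣ α ∣ ℕ.* ℤ.∣ δ ∣ ≡ 1
      ∣α∣∣δ∣≡1 = trans (sym (ℤ.abs-* α δ)) (cong ℤ.∣_∣ αδ≡1)

    -- 4 β Q(u, v) = (2 β u + (δ - α) v)² - disc v², and disc lies strictly between two squares
    Q≢0 : 2 < ℤ.∣ tr A ∣ → ∀ n → NonZeroVec n → Q n ≢ + 0
    Q≢0 2<∣τ∣ (u , v) n≢0 Q≡0 = n≢0 (u≡0 , v≡0)
      where
      W = + 2 * β * u + (δ - α) * v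
      completed-square : + 4 * β * Q (u , v) ≡ W * W - disc * (v * v)
      completed-square = modulo-det (- (+ 4 * (v * v))) (identity α β γ δ u v)
        where
        identity : ∀ α β γ δ u v → + 4 * β * (u * (u * β + v * δ) - v * (u * α + v * γ))
          ≡ (+ 2 * β * u + (δ - α) * v) * (+ 2 * β * u + (δ - α) * v) - ((α + δ) * (α + δ) - + 4) * (v * v)
            + - (+ 4 * (v * v)) * (+ 1 - (α * δ - β * γ))
        identity = solve-∀
      W²≡disc*v² : W * W ≡ disc * (v * v)
      W²≡disc*v² = ℤ.i-j≡0⇒i≡j (W * W) (disc * (v * v)) (trans (sym completed-square) (trans (cong (+ 4 * β *_) Q≡0) (ℤ.*-zeroʳ (+ 4 * β))))
      v≡0 : v ≡ + 0
      v≡0 = ℤ.∣i∣≡0⇒i≡0 (nonsquare-irrational {proj₁ bounds} {ℤ.∣ disc ∣} {ℤ.∣ v ∣} {ℤ.∣ W ∣} (proj₁ (proj₂ bounds)) (proj₂ (proj₂ bounds)) (begin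
        ℤ.∣ disc ∣ ℕ.* (ℤ.∣ v ∣ ℕ.* ℤ.∣ v ∣) ≡⟨ cong (ℤ.∣ disc ∣ ℕ.*_) (sym (ℤ.abs-* v v)) ⟩
        ℤ.∣ disc ∣ ℕ.* ℤ.∣ v * v ∣          ≡⟨ sym (ℤ.abs-* disc (v * v)) ⟩
        ℤ.∣ disc * (v * v) ∣                ≡⟨ cong ℤ.∣_∣ (sym W²≡disc*v²) ⟩
        ℤ.∣ W * W ∣                         ≡⟨ ℤ.abs-* W W ⟩
        ℤ.∣ W ∣ ℕ.* ℤ.∣ W ∣                 ∎))
        where
        open ≡-Reasoning
        bounds = disc-between-squares (tr A) 2<∣τ∣
      Q[u,0] : ∀ u → Q (u , + 0) ≡ β * (u * u)
      Q[u,0] u = identity α β γ δ u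
        where
        identity : ∀ α β γ δ u → u * (u * β + + 0 * δ) - + 0 * (u * α + + 0 * γ) ≡ β * (u * u)
        identity = solve-∀
      u≡0 : u ≡ + 0
      u≡0 = [ (λ β≡0 → ⊥-elim (β≢0 2<∣τ∣ β≡0)) , (λ u²≡0 → [ id , id ]′ (ℤ.i*j≡0⇒i≡0∨j≡0 u u²≡0)) ]′
              (ℤ.i*j≡0⇒i≡0∨j≡0 β (trans (sym (Q[u,0] u)) (trans (cong (λ v → Q (u , v)) (sym v≡0)) Q≡0)))

    ∣Q∣≤ : ∀ n → ℤ.∣ Q n ∣ ≤ (ℤ.∣ α ∣ ℕ.+ ℤ.∣ β ∣ ℕ.+ ℤ.∣ γ ∣ ℕ.+ ℤ.∣ δ ∣) ℕ.* normSq n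
    ∣Q∣≤ (u , v) = begin
      ℤ.∣ Q (u , v) ∣
        ≤⟨ ℤ.∣i-j∣≤∣i∣+∣j∣ (u * (u * β + v * δ)) (v * (u * α + v * γ)) ⟩
      ℤ.∣ u * (u * β + v * δ) ∣ ℕ.+ ℤ.∣ v * (u * α + v * γ) ∣
        ≡⟨ cong₂ ℕ._+_ (ℤ.abs-* u _) (ℤ.abs-* v _) ⟩
      U ℕ.* ℤ.∣ u * β + v * δ ∣ ℕ.+ V ℕ.* ℤ.∣ u * α + v * γ ∣
        ≤⟨ ℕ.+-mono-≤ (ℕ.*-monoʳ-≤ U (∣xb+yd∣≤ u β v δ)) (ℕ.*-monoʳ-≤ V (∣xb+yd∣≤ u α v γ)) ⟩
      U ℕ.* (U ℕ.* B ℕ.+ V ℕ.* D) ℕ.+ V ℕ.* (U ℕ.* A′ ℕ.+ V ℕ.* C)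
        ≡⟨ ℕ-solve 6 (λ U V A′ B C D → U :* (U :* B :+ V :* D) :+ V :* (U :* A′ :+ V :* C) :=
                     B :* (U :* U) :+ D :* (U :* V) :+ A′ :* (U :* V) :+ C :* (V :* V)) refl U V A′ B C D ⟩
      B ℕ.* (U ℕ.* U) ℕ.+ D ℕ.* (U ℕ.* V) ℕ.+ A′ ℕ.* (U ℕ.* V) ℕ.+ C ℕ.* (V ℕ.* V)
        ≤⟨ ℕ.+-mono-≤ (ℕ.+-mono-≤ (ℕ.+-mono-≤ (ℕ.*-monoʳ-≤ B (ℕ.m≤m+n (U ℕ.* U) (V ℕ.* V))) (ℕ.*-monoʳ-≤ D (UV≤ U V)))
                                                (ℕ.*-monoʳ-≤ A′ (UV≤ U V))) (ℕ.*-monoʳ-≤ C (ℕ.m≤n+m (V ℕ.* V) (U ℕ.* U))) ⟩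
      B ℕ.* S ℕ.+ D ℕ.* S ℕ.+ A′ ℕ.* S ℕ.+ C ℕ.* S
        ≡⟨ ℕ-solve 5 (λ A′ B C D S → B :* S :+ D :* S :+ A′ :* S :+ C :* S := (A′ :+ B :+ C :+ D) :* S) refl A′ B C D S ⟩
      (A′ ℕ.+ B ℕ.+ C ℕ.+ D) ℕ.* S
        ≡⟨ cong ((A′ ℕ.+ B ℕ.+ C ℕ.+ D) ℕ.*_) (sym (normSq≡ u v)) ⟩
      (A′ ℕ.+ B ℕ.+ C ℕ.+ D) ℕ.* normSq (u , v) ∎
      where
      open ℕ.≤-Reasoning
      open import Data.Nat.Solver using (module +-*-Solver)
      open +-*-Solver renaming (solve to ℕ-solve)
      U = ℤ.∣ u ∣
      V = ℤ.∣ v ∣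
      A′ = ℤ.∣ α ∣
      B = ℤ.∣ β ∣
      C = ℤ.∣ γ ∣
      D = ℤ.∣ δ ∣
      S = U ℕ.* U ℕ.+ V ℕ.* V
      ∣xb+yd∣≤ : ∀ x b y d → ℤ.∣ x * b + y * d ∣ ≤ ℤ.∣ x ∣ ℕ.* ℤ.∣ b ∣ ℕ.+ ℤ.∣ y ∣ ℕ.* ℤ.∣ d ∣
      ∣xb+yd∣≤ x b y d = ℕ.≤-trans (ℤ.∣i+j∣≤∣i∣+∣j∣ (x * b) (y * d)) (ℕ.≤-reflexive (cong₂ ℕ._+_ (ℤ.abs-* x b) (ℤ.abs-* y d)))
      UV≤ : ∀ U V → U ℕ.* V ≤ U ℕ.* U ℕ.+ V ℕ.* V
      UV≤ U V with ℕ.≤-total U V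
      ... | inj₁ U≤V = ℕ.≤-trans (ℕ.*-monoˡ-≤ V U≤V) (ℕ.m≤n+m (V ℕ.* V) (U ℕ.* U))
      ... | inj₂ V≤U = ℕ.≤-trans (ℕ.*-monoʳ-≤ U V≤U) (ℕ.m≤m+n (U ℕ.* U) (V ℕ.* V))

module Quadruples where

  open import Data.Nat as ℕ using (ℕ; suc; _≤_; _<_; _∸_; _^_; z≤n; s≤s; NonZero)
  import Data.Nat.Properties as ℕ
  import Data.Nat.Divisibility as ℕ∣
  open import Data.Nat.DivMod using (_/_)
  open import Data.Nat.Primality using (Prime; prime?)
  open import Data.Nat.Primality.Factorisation using (factorise; PrimeFactorisation)
  open import Data.Nat.ListAction using (product; sum)
  open import Data.Nat.ListAction.Properties using (∈⇒∣product)
  open import Data.Integer as ℤ using (ℤ; +_)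
  import Data.Integer.Properties as ℤ
  import Data.Integer.Divisibility.Signed as ℤ∣
  open import Data.List using (List; _++_; filter; length; map; concatMap; upTo)
  open import Data.List.Relation.Unary.All as All using (All)
  import Data.List.Relation.Unary.All.Properties as All
  open import Data.List.Relation.Unary.Any using (any?)
  open import Data.List.Relation.Unary.Unique.Propositional using (Unique)
  import Data.List.Relation.Unary.Unique.Propositional.Properties as Unique
  open import Data.List.Membership.Propositional using (_∈_)
  open import Data.List.Membership.Propositional.Properties using (∈-filter⁺; ∈-filter⁻; ∈-++⁺ˡ; ∈-++⁺ʳ; ∈-++⁻; ∈-upTo⁺)
  open import Data.List.Relation.Binary.Permutation.Propositional using (_↭_; ↭-sym)
  open import Data.List.Relation.Binary.Permutation.Propositional.Properties using (∈-resp-↭; All-resp-↭)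
  open import Data.Product using (∃; _×_; _,_; proj₁; proj₂)
  open import Data.Sum using (_⊎_; [_,_]′)
  open import Function using (_∘_; id)
  open import Relation.Binary.PropositionalEquality
  open import Relation.Nullary using (¬_; Dec; yes; no; ¬?)
  open import Relation.Nullary.Decidable using (_×-dec_; from-yes; toSum)
  open import Relation.Unary using (Decidable)
  open import Defs
  open Periods
  open Counting
  open Colourings
  open Arithmetic
  open Quadratic
  open Matrices
  open Discriminant using (disc-between-squares)

  Quad : Set
  Quad = ℕ × ℕ × ℕ × ℕ

  module QuadrupleCount (α β γ δ : ℤ) (det≡1 : det (mat α β γ δ) ≡ + 1) (2<∣τ∣ : 2 < ℤ.∣ α ℤ.+ δ ∣)
    (N : ℕ) (squarefree : Squarefree N) (n : Vec2) (n≢0 : NonZeroVec n)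
    (o : ℕ) (isOrd : IsOrd (mat α β γ δ) N o) where

    open PowersOfA α β γ δ det≡1
    open QuadraticRing (α ℤ.+ δ)

    N≢0 : N ≢ 0
    N≢0 refl = squarefree 2 (from-yes (prime? 2)) (ℕ∣.divides 0 refl)

    instance
      N-nonZero : NonZero N
      N-nonZero = ℕ.≢-nonZero N≢0

    fs : List ℕ
    fs = PrimeFactorisation.factors (factorise N)

    N≡Πfs : N ≡ product fs
    N≡Πfs = PrimeFactorisation.isFactorisation (factorise N)

    fs-prime : All Prime fs
    fs-prime = PrimeFactorisation.factorsPrime (factorise N)

    fs-unique : Unique fs
    fs-unique = squarefree⇒unique fs fs-prime (subst Squarefree N≡Πfs squarefree)

    ∈fs⇒∣N : ∀ {p} → p ∈ fs → p ℕ∣.∣ N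
    ∈fs⇒∣N p∈fs = subst (_ ℕ∣.∣_) (sym N≡Πfs) (∈⇒∣product p∈fs)

    -- the primes of N at which the congruence can degenerate: those dividing Q n or disc
    K : ℤ
    K = Q n ℤ.* disc

    K≢0 : K ≢ + 0
    K≢0 K≡0 = [ Q≢0 2<∣τ∣ n n≢0 , disc≢0 ]′ (ℤ.i*j≡0⇒i≡0∨j≡0 (Q n) K≡0)
      where
      disc≢0 : disc ≢ + 0
      disc≢0 disc≡0 = let s , s²<∣disc∣ , _ = disc-between-squares (α ℤ.+ δ) 2<∣τ∣ in
                      ℕ.<⇒≢ (ℕ.≤-<-trans z≤n s²<∣disc∣) (sym (cong ℤ.∣_∣ disc≡0))

    goods bads : List ℕ
    goods = filter (λ p → ¬? (+ p ℤ∣.∣? K)) fs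
    bads = filter (λ p → + p ℤ∣.∣? K) fs

    record GoodPrime (p : ℕ) : Set where
      field
        prime : Prime p
        ∣N : p ℕ∣.∣ N
        ∤Q : ¬ + p ℤ∣.∣ Q n
        ∤disc : ¬ + p ℤ∣.∣ disc

    good : ∀ {p} → p ∈ goods → GoodPrime p
    good p∈goods with ∈-filter⁻ (λ p → ¬? (+ p ℤ∣.∣? K)) {xs = fs} p∈goods
    ... | p∈fs , p∤K = record
      { prime = All.lookup fs-prime p∈fs
      ; ∣N = ∈fs⇒∣N p∈fs
      ; ∤Q = λ p∣Q → p∤K (ℤ∣.∣m⇒∣m*n disc p∣Q)
      ; ∤disc = λ p∣disc → p∤K (ℤ∣.∣n⇒∣m*n (Q n) p∣disc)
      }

    ξ^o≡1 : ∀ {p} → p ∈ goods → ξ^ o ≡ᴿ 1ᴿ [mod p ]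
    ξ^o≡1 {p} p∈goods = ≡ᴹI⇒≡ᴿ1 prime ∤disc (ξ^ o) (subst (_≡ᴹ I₂ [mod p ]) (A^≡toMatrix o) (≡ᴹ-∣ (A ^ᴹ o) I₂ ∣N (proj₁ (proj₂ isOrd))))
      where open GoodPrime (good p∈goods)

    ≡ᴿ-mod-N : ∀ {X Y} → All (X ≡ᴿ Y [mod_]) fs → X ≡ᴿ Y [mod N ]
    ≡ᴿ-mod-N = subst (_ ≡ᴿ _ [mod_]) (sym N≡Πfs) ∘ ≡ᴿ-product fs-unique fs-prime

    Congruent : Quad → Set
    Congruent (i , j , k , l) = Vec≡0mod (n ·ᴹ ((((A ^ᴹ i) ⊖ (A ^ᴹ j)) ⊕ (A ^ᴹ k)) ⊖ (A ^ᴹ l))) N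

    congruent? : Decidable Congruent
    congruent? (i , j , k , l) = Vec≡0mod? (n ·ᴹ ((((A ^ᴹ i) ⊖ (A ^ᴹ j)) ⊕ (A ^ᴹ k)) ⊖ (A ^ᴹ l))) N

    Pairs₁ Pairs₂ Opposite : Quad → ℕ → Set
    Pairs₁ (i , j , k , l) p = ξ^ i ≡ᴿ ξ^ j [mod p ] × ξ^ k ≡ᴿ ξ^ l [mod p ]
    Pairs₂ (i , j , k , l) p = ξ^ i ≡ᴿ ξ^ l [mod p ] × ξ^ k ≡ᴿ ξ^ j [mod p ]
    Opposite (i , j , k , l) p = ξ^ k ≡ᴿ neg (ξ^ i) [mod p ] × ξ^ l ≡ᴿ neg (ξ^ j) [mod p ]

    congruent⇒cases : ∀ q → Congruent q → ∀ {p} → p ∈ goods → Pairs₁ q p ⊎ Pairs₂ q p ⊎ Opposite q p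
    congruent⇒cases (i , j , k , l) congruent {p} p∈goods =
      four-units prime ∤disc (ξ^ i) (ξ^ j) (ξ^ k) (ξ^ l) (norm-ξ^ i) (norm-ξ^ j) (norm-ξ^ k) (norm-ξ^ l)
        (·toMatrix≡0⇒∣ᴿ prime n ∤Q (ξ^ i ⊟ ξ^ j ⊞ ξ^ k ⊟ ξ^ l) (subst (λ M → Vec≡0mod (n ·ᴹ M) p) (A^-alternating-sum i j k l)
          (Vec≡0mod-∣ (n ·ᴹ ((((A ^ᴹ i) ⊖ (A ^ᴹ j)) ⊕ (A ^ᴹ k)) ⊖ (A ^ᴹ l))) ∣N congruent)))
      where
      open GoodPrime (good p∈goods)

    ≡ᴿ? : ∀ p X Y → Dec (X ≡ᴿ Y [mod p ])
    ≡ᴿ? p X Y = ∣ᴿ? p (X ⊟ Y)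

    Coloured : Split ℕ → Quad → Set
    Coloured s q = Colouring {C₁ = Pairs₁ q} {C₂ = Pairs₂ q} {C₃ = Opposite q} s

    coloured? : ∀ s → Decidable (Coloured s)
    coloured? (a , b , c) q@(i , j , k , l) =
      All.all? (λ p → ≡ᴿ? p (ξ^ i) (ξ^ j) ×-dec ≡ᴿ? p (ξ^ k) (ξ^ l)) a ×-dec
      All.all? (λ p → ≡ᴿ? p (ξ^ i) (ξ^ l) ×-dec ≡ᴿ? p (ξ^ k) (ξ^ j)) b ×-dec
      All.all? (λ p → ≡ᴿ? p (ξ^ k) (neg (ξ^ i)) ×-dec ≡ᴿ? p (ξ^ l) (neg (ξ^ j))) c

    count-≤-colourings : count congruent? (quads o) ≤ sum (map (λ s → count (coloured? s) (quads o)) (splits goods))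
    count-≤-colourings = ℕ.≤-trans
      (count-mono congruent? (λ q → any? (λ s → coloured? s q) (splits goods))
        (λ {q} congruent → colouring-exists goods (All.tabulate (congruent⇒cases q congruent))) (quads o))
      (count-any-≤-sum coloured? (splits goods) (quads o))

    order-mod : ∀ ps → (∀ {p} → p ∈ ps → p ∈ goods) → ∃ (LeastPositive (ξ-Period ps))
    order-mod ps ps⊆goods = least-positive (ξ-period? ps) o (proj₁ isOrd) (All.tabulate (ξ^o≡1 ∘ ps⊆goods))

    g : ℕ
    g = product bads

    g∣K : g ℕ∣.∣ ℤ.∣ K ∣
    g∣K = product-∣ (Unique.filter⁺ _ fs-unique) (All.filter⁺ _ fs-prime)
            (All.tabulate λ p∈bads → ℤ∣.∣⇒∣ᵤ (proj₂ (∈-filter⁻ (λ p → + p ℤ∣.∣? K) {xs = fs} p∈bads)))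

    instance
      ∣K∣-nonZero : NonZero ℤ.∣ K ∣
      ∣K∣-nonZero = ℕ.≢-nonZero (K≢0 ∘ ℤ.∣i∣≡0⇒i≡0)

    g≤∣K∣ : g ≤ ℤ.∣ K ∣
    g≤∣K∣ = ℕ∣.∣⇒≤ g∣K

    1≤g : 1 ≤ g
    1≤g = ℕ.n≢0⇒n>0 λ g≡0 → ℕ.≢-nonZero⁻¹ ℤ.∣ K ∣ (ℕ∣.0∣⇒≡0 (subst (ℕ∣._∣ ℤ.∣ K ∣) g≡0 g∣K))

    module Exponents {o-good e : ℕ} (order-good : LeastPositive (ξ-Period goods) o-good)
                     (1≤e : 1 ≤ e) (ξ^e≡1 : ξ^ e ≡ᴿ 1ᴿ [mod g ]) where

      -- at a good prime ξ^o-good ≡ 1, at a bad one ξ^e ≡ 1, so A^(o-good·e) ≡ I modulo N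
      o≤o-good*e : o ≤ o-good ℕ.* e
      o≤o-good*e = leastPositive-≤ isOrd (ℕ.*-mono-≤ (proj₁ order-good) 1≤e)
        (subst (_≡ᴹ I₂ [mod N ]) (sym (A^≡toMatrix (o-good ℕ.* e))) (≡ᴿ1⇒≡ᴹI _ (≡ᴿ-mod-N (All.tabulate at))))
        where
        at : ∀ {p} → p ∈ fs → ξ^ (o-good ℕ.* e) ≡ᴿ 1ᴿ [mod p ]
        at {p} p∈fs = [ bad , good′ ]′ (toSum (+ p ℤ∣.∣? K))
          where
          bad : + p ℤ∣.∣ K → ξ^ (o-good ℕ.* e) ≡ᴿ 1ᴿ [mod p ]
          bad p∣K = ξ^-multiple o-good (≡ᴿ-∣ (∈⇒∣product (∈-filter⁺ (λ p → + p ℤ∣.∣? K) p∈fs p∣K)) ξ^e≡1)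
          good′ : ¬ + p ℤ∣.∣ K → ξ^ (o-good ℕ.* e) ≡ᴿ 1ᴿ [mod p ]
          good′ p∤K = subst (λ k → ξ^ k ≡ᴿ 1ᴿ [mod p ]) (ℕ.*-comm e o-good)
                        (ξ^-multiple e (All.lookup (proj₁ (proj₂ order-good)) (∈-filter⁺ (λ p → ¬? (+ p ℤ∣.∣? K)) p∈fs p∤K)))

      module Leaf {a b c : List ℕ} (split : a ++ b ++ c ↭ goods) {o₁ o₂₃ : ℕ}
                  (order₁ : LeastPositive (ξ-Period a) o₁) (order₂₃ : LeastPositive (ξ-Period (b ++ c)) o₂₃) where

        instance
          o₁-nonZero : NonZero o₁
          o₁-nonZero = ℕ.>-nonZero (proj₁ order₁)
          o₂₃-nonZero : NonZero o₂₃
          o₂₃-nonZero = ℕ.>-nonZero (proj₁ order₂₃)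
          o-good-nonZero : NonZero o-good
          o-good-nonZero = ℕ.>-nonZero (proj₁ order-good)

        o-good≤o₁*o₂₃ : o-good ≤ o₁ ℕ.* o₂₃
        o-good≤o₁*o₂₃ = leastPositive-≤ order-good (ℕ.*-mono-≤ (proj₁ order₁) (proj₁ order₂₃))
          (All.tabulate (λ p∈goods → [ in-a , in-bc ]′ (∈-++⁻ a (∈-resp-↭ (↭-sym split) p∈goods))))
          where
          in-a : ∀ {p} → p ∈ a → ξ^ (o₁ ℕ.* o₂₃) ≡ᴿ 1ᴿ [mod p ]
          in-a {p} p∈a = subst (λ k → ξ^ k ≡ᴿ 1ᴿ [mod p ]) (ℕ.*-comm o₂₃ o₁)
                           (ξ^-multiple o₂₃ (All.lookup (proj₁ (proj₂ order₁)) p∈a))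
          in-bc : ∀ {p} → p ∈ b ++ c → ξ^ (o₁ ℕ.* o₂₃) ≡ᴿ 1ᴿ [mod p ]
          in-bc p∈bc = ξ^-multiple o₁ (All.lookup (proj₁ (proj₂ order₂₃)) p∈bc)

        Fibre-j : ℕ → ℕ → Set
        Fibre-j i j = All (λ p → ξ^ i ≡ᴿ ξ^ j [mod p ]) a

        Fibre-k : ℕ → ℕ → ℕ → Set
        Fibre-k i j k = All (λ p → ξ^ k ≡ᴿ ξ^ j [mod p ]) b × All (λ p → ξ^ k ≡ᴿ neg (ξ^ i) [mod p ]) c

        Fibre-l : ℕ → ℕ → ℕ → ℕ → Set
        Fibre-l i j k l = All (λ p → ξ^ k ≡ᴿ ξ^ l [mod p ]) a × All (λ p → ξ^ i ≡ᴿ ξ^ l [mod p ]) b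
                       × All (λ p → ξ^ l ≡ᴿ neg (ξ^ j) [mod p ]) c

        fibre-j? : ∀ i → Decidable (Fibre-j i)
        fibre-j? i j = All.all? (λ p → ≡ᴿ? p (ξ^ i) (ξ^ j)) a

        fibre-k? : ∀ i j → Decidable (Fibre-k i j)
        fibre-k? i j k = All.all? (λ p → ≡ᴿ? p (ξ^ k) (ξ^ j)) b ×-dec All.all? (λ p → ≡ᴿ? p (ξ^ k) (neg (ξ^ i))) c

        fibre-l? : ∀ i j k → Decidable (Fibre-l i j k)
        fibre-l? i j k l = All.all? (λ p → ≡ᴿ? p (ξ^ k) (ξ^ l)) a ×-dec All.all? (λ p → ≡ᴿ? p (ξ^ i) (ξ^ l)) b
                        ×-dec All.all? (λ p → ≡ᴿ? p (ξ^ l) (neg (ξ^ j))) c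

        module _ (i j k l : ℕ) (coloured : Coloured (a , b , c) (i , j , k , l)) where

          coloured⇒fibre-j : Fibre-j i j
          coloured⇒fibre-j = proj₁ (All.unzip (proj₁ coloured))

          coloured⇒fibre-k : Fibre-k i j k
          coloured⇒fibre-k = proj₂ (All.unzip (proj₁ (proj₂ coloured))) , proj₁ (All.unzip (proj₂ (proj₂ coloured)))

          coloured⇒fibre-l : Fibre-l i j k l
          coloured⇒fibre-l = proj₂ (All.unzip (proj₁ coloured)) , proj₁ (All.unzip (proj₁ (proj₂ coloured)))
                          , proj₂ (All.unzip (proj₂ (proj₂ coloured)))

        private
          from-common : ∀ {ps Z X Y} → All (λ p → Z ≡ᴿ X [mod p ]) ps → All (λ p → Z ≡ᴿ Y [mod p ]) ps → X ≡ᴿ Y [mod-all ps ]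
          from-common Z≡X Z≡Y = All.zipWith (λ (Z≡X , Z≡Y) → ≡ᴿ-trans (≡ᴿ-sym Z≡X) Z≡Y) (Z≡X , Z≡Y)

          to-common : ∀ {ps Z X Y} → All (λ p → X ≡ᴿ Z [mod p ]) ps → All (λ p → Y ≡ᴿ Z [mod p ]) ps → X ≡ᴿ Y [mod-all ps ]
          to-common X≡Z Y≡Z = All.zipWith (λ (X≡Z , Y≡Z) → ≡ᴿ-trans X≡Z (≡ᴿ-sym Y≡Z)) (X≡Z , Y≡Z)

        F? : Decidable (Coloured (a , b , c))
        F? = coloured? (a , b , c)

        ls : ℕ → ℕ → ℕ → List Quad
        ls i j k = map (λ l → (i , j , k , l)) (range1 o)

        ks : ℕ → ℕ → List Quad
        ks i j = concatMap (ls i j) (range1 o)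

        js : ℕ → List Quad
        js i = concatMap (ks i) (range1 o)

        o₁∣o : o₁ ℕ∣.∣ o
        o₁∣o = order-∣ order₁ (All.tabulate (ξ^o≡1 ∘ ∈-resp-↭ split ∘ ∈-++⁺ˡ))

        o₂₃∣o : o₂₃ ℕ∣.∣ o
        o₂₃∣o = order-∣ order₂₃ (All.tabulate (ξ^o≡1 ∘ ∈-resp-↭ split ∘ ∈-++⁺ʳ a))

        o-good∣o : o-good ℕ∣.∣ o
        o-good∣o = order-∣ order-good (All.tabulate ξ^o≡1)

        count-l : ∀ i j k → count F? (ls i j k) ≤ o / o-good
        count-l i j k = begin
          count F? (ls i j k)                               ≡⟨ count-map F? (λ l → (i , j , k , l)) (range1 o) ⟩
          count (F? ∘ (λ l → (i , j , k , l))) (range1 o)  ≤⟨ count-mono _ (fibre-l? i j k) (λ {l} → coloured⇒fibre-l i j k l) (range1 o) ⟩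
          count (fibre-l? i j k) (range1 o)                 ≤⟨ count-residue-class-≤ (fibre-l? i j k) o o-good∣o congruent ⟩
          o / o-good                                        ∎
          where
          open ℕ.≤-Reasoning
          congruent : ∀ {x y} → Fibre-l i j k x → Fibre-l i j k y → y ≤ x → o-good ℕ∣.∣ x ∸ y
          congruent (a-x , b-x , c-x) (a-y , b-y , c-y) y≤x = order-∣-∸ order-good y≤x
            (All-resp-↭ split (All.++⁺ (from-common a-x a-y) (All.++⁺ (from-common b-x b-y) (to-common c-x c-y))))

        count-l-empty : ∀ i j k → ¬ (Fibre-j i j × Fibre-k i j k) → count F? (ls i j k) ≡ 0
        count-l-empty i j k ¬fibre = trans (count-map F? (λ l → (i , j , k , l)) (range1 o))
          (count-none _ (λ l coloured → ¬fibre (coloured⇒fibre-j i j k l coloured , coloured⇒fibre-k i j k l coloured)) (range1 o))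

        count-k : ∀ i j → count F? (ks i j) ≤ o / o₂₃ ℕ.* (o / o-good)
        count-k i j = ℕ.≤-trans
          (count-concatMap-≤ F? (fibre-k? i j) (ls i j) (λ k _ → count-l i j k)
            (λ k ¬fibre-k → count-l-empty i j k (¬fibre-k ∘ proj₂)) (range1 o))
          (ℕ.*-monoˡ-≤ (o / o-good) (count-residue-class-≤ (fibre-k? i j) o o₂₃∣o congruent))
          where
          congruent : ∀ {x y} → Fibre-k i j x → Fibre-k i j y → y ≤ x → o₂₃ ℕ∣.∣ x ∸ y
          congruent (b-x , c-x) (b-y , c-y) y≤x = order-∣-∸ order₂₃ y≤x (All.++⁺ (to-common b-x b-y) (to-common c-x c-y))

        count-k-empty : ∀ i j → ¬ Fibre-j i j → count F? (ks i j) ≡ 0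
        count-k-empty i j ¬fibre-j = count-concatMap-≡0 F? (ls i j) (λ k → count-l-empty i j k (¬fibre-j ∘ proj₁)) (range1 o)

        count-j : ∀ i → count F? (js i) ≤ o / o₁ ℕ.* (o / o₂₃ ℕ.* (o / o-good))
        count-j i = ℕ.≤-trans
          (count-concatMap-≤ F? (fibre-j? i) (ks i) (λ j _ → count-k i j) (count-k-empty i) (range1 o))
          (ℕ.*-monoˡ-≤ (o / o₂₃ ℕ.* (o / o-good)) (count-residue-class-≤ (fibre-j? i) o o₁∣o congruent))
          where
          congruent : ∀ {x y} → Fibre-j i x → Fibre-j i y → y ≤ x → o₁ ℕ∣.∣ x ∸ y
          congruent a-x a-y y≤x = order-∣-∸ order₁ y≤x (from-common a-x a-y)

        count-coloured : count F? (quads o) ≤ (o ℕ.* o) ℕ.* (e ℕ.* e)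
        count-coloured = begin
          count F? (concatMap js (range1 o))                     ≤⟨ count-concatMap-≤-length F? js count-j (range1 o) ⟩
          length (range1 o) ℕ.* (o / o₁ ℕ.* (o / o₂₃ ℕ.* (o / o-good)))
                                                                ≡⟨ cong (ℕ._* (o / o₁ ℕ.* (o / o₂₃ ℕ.* (o / o-good)))) (length-range1 o) ⟩
          o ℕ.* (o / o₁ ℕ.* (o / o₂₃ ℕ.* (o / o-good)))         ≤⟨ quotients-≤ o₁∣o o₂₃∣o o-good∣o o-good≤o₁*o₂₃ o≤o-good*e ⟩
          (o ℕ.* o) ℕ.* (e ℕ.* e)                                ∎
          where open ℕ.≤-Reasoning

      count-congruent-≤ : count congruent? (quads o) ≤ 3 ^ length goods ℕ.* ((o ℕ.* o) ℕ.* (e ℕ.* e))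
      count-congruent-≤ = begin
        count congruent? (quads o)                                        ≤⟨ count-≤-colourings ⟩
        sum (map (λ s → count (coloured? s) (quads o)) (splits goods))    ≤⟨ sum-map-≤ (λ s → count (coloured? s) (quads o)) (splits goods) leaf ⟩
        length (splits goods) ℕ.* ((o ℕ.* o) ℕ.* (e ℕ.* e))               ≡⟨ cong (ℕ._* ((o ℕ.* o) ℕ.* (e ℕ.* e))) (length-splits goods) ⟩
        3 ^ length goods ℕ.* ((o ℕ.* o) ℕ.* (e ℕ.* e))                    ∎
        where
        open ℕ.≤-Reasoning
        leaf : ∀ {s} → s ∈ splits goods → count (coloured? s) (quads o) ≤ (o ℕ.* o) ℕ.* (e ℕ.* e)
        leaf {a , b , c} s∈splits = Leaf.count-coloured split
          (proj₂ (order-mod a (∈-resp-↭ split ∘ ∈-++⁺ˡ))) (proj₂ (order-mod (b ++ c) (∈-resp-↭ split ∘ ∈-++⁺ʳ a)))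
          where split = splits-↭ s∈splits

    length-goods≤ω : length goods ≤ ω N
    length-goods≤ω = unique-⊆⇒length-≤ ℕ._≟_ (Unique.filter⁺ (λ p → ¬? (+ p ℤ∣.∣? K)) fs-unique)
      (Unique.filter⁺ (λ p → prime? p ×-dec (p ℕ∣.∣? N)) (Unique.upTo⁺ (suc N))) goods⊆
      where
      goods⊆ : ∀ {p} → p ∈ goods → p ∈ filter (λ p → prime? p ×-dec (p ℕ∣.∣? N)) (upTo (suc N))
      goods⊆ p∈goods = ∈-filter⁺ (λ p → prime? p ×-dec (p ℕ∣.∣? N)) (∈-upTo⁺ (s≤s (ℕ∣.∣⇒≤ ∣N))) (prime , ∣N)
        where open GoodPrime (good p∈goods)

    e²-bound : ∀ {e} → e ≤ g ℕ.* g →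
      e ℕ.* e ≤ ((ℤ.∣ α ∣ ℕ.+ ℤ.∣ β ∣ ℕ.+ ℤ.∣ γ ∣ ℕ.+ ℤ.∣ δ ∣) ℕ.* ℤ.∣ disc ∣) ^ 4 ℕ.* normSq n ^ 4
    e²-bound {e} e≤g² = begin
      e ℕ.* e                     ≤⟨ ℕ.*-mono-≤ e≤g² e≤g² ⟩
      (g ℕ.* g) ℕ.* (g ℕ.* g)     ≤⟨ ℕ.*-mono-≤ (ℕ.*-mono-≤ g≤G g≤G) (ℕ.*-mono-≤ g≤G g≤G) ⟩
      (G ℕ.* G) ℕ.* (G ℕ.* G)     ≡⟨ solve 3 (λ m s d → (m :* s :* d :* (m :* s :* d)) :* (m :* s :* d :* (m :* s :* d))
                                                 := (m :* d) :^ 4 :* s :^ 4) refl m S ℤ.∣ disc ∣ ⟩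
      (m ℕ.* ℤ.∣ disc ∣) ^ 4 ℕ.* S ^ 4 ∎
      where
      open ℕ.≤-Reasoning
      open import Data.Nat.Solver using (module +-*-Solver)
      open +-*-Solver
      m = ℤ.∣ α ∣ ℕ.+ ℤ.∣ β ∣ ℕ.+ ℤ.∣ γ ∣ ℕ.+ ℤ.∣ δ ∣
      S = normSq n
      G = m ℕ.* S ℕ.* ℤ.∣ disc ∣
      g≤G : g ≤ G
      g≤G = ℕ.≤-trans g≤∣K∣ (ℕ.≤-trans (ℕ.≤-reflexive (ℤ.abs-* (Q n) disc)) (ℕ.*-monoˡ-≤ ℤ.∣ disc ∣ (∣Q∣≤ n)))

    quadCount-≤ : count congruent? (quads o)
      ≤ ((ℤ.∣ α ∣ ℕ.+ ℤ.∣ β ∣ ℕ.+ ℤ.∣ γ ∣ ℕ.+ ℤ.∣ δ ∣) ℕ.* ℤ.∣ disc ∣) ^ 4 ℕ.* 3 ^ ω N ℕ.* o ^ 2 ℕ.* normSq n ^ 4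
    quadCount-≤ = from-exponent (ξ^-returns g 1≤g)
      where
      open ℕ.≤-Reasoning
      open import Data.Nat.Solver using (module +-*-Solver)
      open +-*-Solver
      C = ((ℤ.∣ α ∣ ℕ.+ ℤ.∣ β ∣ ℕ.+ ℤ.∣ γ ∣ ℕ.+ ℤ.∣ δ ∣) ℕ.* ℤ.∣ disc ∣) ^ 4
      S = normSq n
      from-exponent : (∃ λ e → 1 ≤ e × e ≤ g ℕ.* g × ξ^ e ≡ᴿ 1ᴿ [mod g ]) → count congruent? (quads o) ≤ C ℕ.* 3 ^ ω N ℕ.* o ^ 2 ℕ.* S ^ 4
      from-exponent (e , 1≤e , e≤g² , ξ^e≡1) = begin
        count congruent? (quads o)                     ≤⟨ Exponents.count-congruent-≤ (proj₂ (order-mod goods id)) 1≤e ξ^e≡1 ⟩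
        3 ^ length goods ℕ.* ((o ℕ.* o) ℕ.* (e ℕ.* e)) ≤⟨ ℕ.*-mono-≤ (ℕ.^-monoʳ-≤ 3 length-goods≤ω) (ℕ.*-monoʳ-≤ (o ℕ.* o) (e²-bound e≤g²)) ⟩
        3 ^ ω N ℕ.* ((o ℕ.* o) ℕ.* (C ℕ.* S ^ 4))      ≡⟨ solve 4 (λ w o C s → w :* ((o :* o) :* (C :* s)) := C :* w :* o :^ 2 :* s) refl (3 ^ ω N) o C (S ^ 4) ⟩
        C ℕ.* 3 ^ ω N ℕ.* o ^ 2 ℕ.* S ^ 4              ∎

open import Data.Nat as ℕ using (ℕ; zero; suc; _≤_; _<_; _*_; _^_; _+_; NonZero)
import Data.Nat.Properties as ℕ
open import Data.Integer as ℤ using (∣_∣)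
open import Data.Product using (Σ; _,_)
open import Relation.Binary.PropositionalEquality
open import Defs
open Matrices using (1≤normSq)
open Quadruples using (module QuadrupleCount)

^-distribʳ-* : ∀ m n k → (m * n) ^ k ≡ m ^ k * n ^ k
^-distribʳ-* m n zero = refl
^-distribʳ-* m n (suc k) = trans (cong (m * n *_) (^-distribʳ-* m n k)) (interchange m n (m ^ k) (n ^ k))
  where
  open import Data.Nat.Solver using (module +-*-Solver)
  open +-*-Solver
  interchange : ∀ m n x y → m * n * (x * y) ≡ m * x * (n * y)
  interchange = solve 4 (λ m n x y → m :* n :* (x :* y) := m :* x :* (n :* y)) refl

power-bound : ∀ X Y S q p → 1 ≤ S → X ≤ Y * S ^ 4 → X ^ (2 * q) ≤ Y ^ (2 * q) * S ^ (8 * q + p)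
power-bound X Y S q p 1≤S X≤YS⁴ = begin
  X ^ (2 * q)                       ≤⟨ ℕ.^-monoˡ-≤ (2 * q) X≤YS⁴ ⟩
  (Y * S ^ 4) ^ (2 * q)             ≡⟨ ^-distribʳ-* Y (S ^ 4) (2 * q) ⟩
  Y ^ (2 * q) * (S ^ 4) ^ (2 * q)   ≡⟨ cong (Y ^ (2 * q) *_) (trans (ℕ.^-*-assoc S 4 (2 * q)) (cong (S ^_) 4*2q≡8q)) ⟩
  Y ^ (2 * q) * S ^ (8 * q)         ≤⟨ ℕ.*-monoʳ-≤ (Y ^ (2 * q)) (ℕ.^-monoʳ-≤ S {{ℕ.>-nonZero 1≤S}} (ℕ.m≤m+n (8 * q) p)) ⟩
  Y ^ (2 * q) * S ^ (8 * q + p)     ∎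
  where
  open ℕ.≤-Reasoning
  4*2q≡8q : 4 * (2 * q) ≡ 8 * q
  4*2q≡8q = sym (ℕ.*-assoc 4 2 q)

-- The bound holds with ε = 0.
lemma3 : (A : Mat2) → InSL2 A → 2 < ∣ tr A ∣ →
    (p q : ℕ) → 1 ≤ p → 1 ≤ q →
    Σ ℕ λ C → (N : ℕ) → Squarefree N → (n : Vec2) → NonZeroVec n →
      (o : ℕ) → IsOrd A N o →
      quadCount A N n o ^ (2 * q)
        ≤ (C * 3 ^ ω N * o ^ 2) ^ (2 * q) * normSq n ^ (8 * q + p)
lemma3 A det≡1 2<∣τ∣ p q _ _ = C , λ N squarefree n n≢0 o order →
  power-bound (quadCount A N n o) (C * 3 ^ ω N * o ^ 2) (normSq n) q p (1≤normSq n n≢0)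
    (QuadrupleCount.quadCount-≤ (a A) (b A) (c A) (d A) det≡1 2<∣τ∣ N squarefree n n≢0 o order)
  where
  C = ((∣ a A ∣ + ∣ b A ∣ + ∣ c A ∣ + ∣ d A ∣) * ∣ tr A ℤ.* tr A ℤ.- ℤ.+ 4 ∣) ^ 4
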